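{- Let $B_{11}$ and $B_{12}$ be the two 18-vertex Blanuša snarks, given on vertex set $\{1,\dots,18\}$ by the edge sets $B_{11}$: $\{2,4\},\{3,4\},\{1,2\},\{1,5\},\{3,5\},\{6,8\},\{16,18\},\{16,17\},\{6,7\},\{2,7\},\{1,8\},\{4,9\},\{5,10\},\{11,15\},\{14,15\},\{12,14\},\{12,13\},\{11,13\},\{14,17\},\{13,16\},\{15,18\},\{8,9\},\{7,10\},\{9,11\},\{6,12\},\{3,18\},\{10,17\}$; $B_{12}$: $\{2,4\},\{3,4\},\{1,2\},\{1,5\},\{3,5\},\{3,6\},\{6,8\},\{8,18\},\{16,18\},\{16,17\},\{7,17\},\{6,7\},\{2,7\},\{1,8\},\{4,9\},\{9,12\},\{5,10\},\{10,11\},\{11,15\},\{14,15\},\{12,14\},\{12,13\},\{11,13\},\{14,17\},\{13,16\},\{15,18\},\{9,10\}$. For each $G \in \{B_{11}, B_{12}\}$, a $G$ design of order $n$ exists if and only if $n \equiv 1 \pmod{27}$.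
   Context: All graphs are simple. For a graph $G$, a $G$ design of order $n$ is a partition of the edge set of the complete graph $K_n$ into edge sets of subgraphs each isomorphic to $G$. By convention the empty set is a $G$ design of order $1$. -}

module Defs where

open import Data.Nat using (ℕ; _∸_)
import Data.Nat as ℕ
open import Data.Bool using (Bool; _∧_; _∨_)
open import Data.Fin using (Fin; #_; _<_)
import Data.Fin as F
open import Data.List using (List; []; _∷_; length; filterᵇ; map)
open import Data.Nat.ListAction using (sum)
open import Data.Product using (_×_; _,_; Σ)
open import Data.List.Membership.Propositional using (_∈_)
open import Relation.Nullary.Decidable using (True; ⌊_⌋)
open import Relation.Binary.PropositionalEquality using (_≡_)

-- A (simple) graph on vertex set Fin v, given by its list of edges.
-- Each pair (a , b) stands for the unordered edge {a , b}.
Graph : ℕ → Set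
Graph v = List (Fin v × Fin v)

-- Vertex with the paper's 1-based label k ∈ {1,…,18}, as an element of Fin 18.
lbl : (k : ℕ) → {p : True ((k ∸ 1) ℕ.<? 18)} → Fin 18
lbl k {p} = #_ (k ∸ 1) {18} {p}

infix 4 _—_
_—_ : (a b : ℕ) → {pa : True ((a ∸ 1) ℕ.<? 18)} → {pb : True ((b ∸ 1) ℕ.<? 18)}
    → Fin 18 × Fin 18
(a — b) {pa} {pb} = lbl a {pa} , lbl b {pb}

B₁₁ : Graph 18
B₁₁ = (2 — 4) ∷ (3 — 4) ∷ (1 — 2) ∷ (1 — 5) ∷ (3 — 5) ∷ (6 — 8) ∷ (16 — 18) ∷
      (16 — 17) ∷ (6 — 7) ∷ (2 — 7) ∷ (1 — 8) ∷ (4 — 9) ∷ (5 — 10) ∷ (11 — 15) ∷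
      (14 — 15) ∷ (12 — 14) ∷ (12 — 13) ∷ (11 — 13) ∷ (14 — 17) ∷ (13 — 16) ∷
      (15 — 18) ∷ (8 — 9) ∷ (7 — 10) ∷ (9 — 11) ∷ (6 — 12) ∷ (3 — 18) ∷ (10 — 17) ∷ []

B₁₂ : Graph 18
B₁₂ = (2 — 4) ∷ (3 — 4) ∷ (1 — 2) ∷ (1 — 5) ∷ (3 — 5) ∷ (3 — 6) ∷ (6 — 8) ∷
      (8 — 18) ∷ (16 — 18) ∷ (16 — 17) ∷ (7 — 17) ∷ (6 — 7) ∷ (2 — 7) ∷ (1 — 8) ∷
      (4 — 9) ∷ (9 — 12) ∷ (5 — 10) ∷ (10 — 11) ∷ (11 — 15) ∷ (14 — 15) ∷
      (12 — 14) ∷ (12 — 13) ∷ (11 — 13) ∷ (14 — 17) ∷ (13 — 16) ∷ (15 — 18) ∷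
      (9 — 10) ∷ []

hitsᵇ : ∀ {v n} → (Fin v → Fin n) → Fin n → Fin n → Fin v × Fin v → Bool
hitsᵇ φ x y (a , b) =
  (⌊ φ a F.≟ x ⌋ ∧ ⌊ φ b F.≟ y ⌋) ∨ (⌊ φ a F.≟ y ⌋ ∧ ⌊ φ b F.≟ x ⌋)

coverCount : ∀ {v n} → Graph v → List (Fin v → Fin n) → Fin n → Fin n → ℕ
coverCount G D x y = sum (map (λ φ → length (filterᵇ (hitsᵇ φ x y) G)) D)

-- A G design of order n: a list of copies of G in K_n (each copy is the image
-- of G under an injective vertex map φ : Fin v → Fin n) such that every edge
-- {x , y} (x < y) of K_n lies in exactly one copy (counted with multiplicity
-- over copies and over edges of G), i.e. the copies' edge sets partition E(K_n).
record IsDesign {v : ℕ} (G : Graph v) (n : ℕ) (D : List (Fin v → Fin n)) : Set where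
  field
    injective : ∀ {φ} → φ ∈ D →
                ∀ a b → φ a ≡ φ b → a ≡ b
    partition : ∀ (x y : Fin n) → x < y → coverCount G D x y ≡ 1

Design : ∀ {v} → Graph v → ℕ → Set
Design {v} G n = Σ (List (Fin v → Fin n)) (IsDesign G n)

-- A G design of order n consists of n(n − 1)/54 copies of G, so 27 ∣ n(n − 1).  Every vertex of a
-- Blanuša snark has degree 3, and the copies through a point partition the n − 1 edges at that point,
-- so 3 ∣ n − 1; hence 3 ∤ n and 27 ∣ n − 1.  Conversely let n = 27q + 1.  For even q = 2K a cyclic
-- design on ℤ_n is developed from K base blocks w ↦ f w + 27 i (c w), whose edges realise every
-- difference ±1, …, ±27K.  For odd q = m the points are ∞ and ℤ_m × ℤ_27: a design of order 28 is
-- placed on each {∞} ∪ {g} × ℤ_27, and the blocks w ↦ (s + d (c w), t + τ w) with 1 ≤ d ≤ (m − 1)/2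
-- cover the pairs from different groups.  As the number of copies is right, covering every edge
-- suffices.  The labellings and the design of order 28 are finite certificates checked by evaluation.

module Submission where

open import Defs
open import Data.Bool using (Bool; true; false; not; T; _∧_; _∨_)
open import Data.Bool.Properties using (T?; ∨-comm; ∨-zeroʳ; ∧-zeroʳ)
open import Data.Empty using (⊥-elim)
open import Data.Fin as F using (Fin; zero; suc; toℕ; combine; remQuot)
import Data.Fin.Properties as FP
open import Data.List using (List; []; _∷_; _++_; length; map; filterᵇ; concatMap; applyUpTo; upTo; allFin)
open import Data.List.Properties using (length-++; length-map; length-applyUpTo; length-upTo; length-tabulate)
open import Data.List.Membership.Propositional using (_∈_; find; lose)
open import Data.List.Membership.Propositional.Properties
  using (∈-filter⁺; ∈-filter⁻; ∈-concatMap⁺; ∈-concatMap⁻; ∈-applyUpTo⁺; ∈-applyUpTo⁻; ∈-upTo⁺; ∈-upTo⁻;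
         ∈-allFin; ∈-map⁺; ∈-map⁻; ∈-++⁺ˡ; ∈-++⁺ʳ; ∈-++⁻)
import Data.List.Membership.DecPropositional as DecMembership
open import Data.List.Relation.Unary.All as All using (All)
open import Data.List.Relation.Unary.Any as Any using (Any; here; there)
open import Data.Nat
open import Data.Nat.DivMod
open import Data.Nat.Divisibility
  using (_∣_; _∣?_; divides; _∣0; 1∣_; ∣-trans; ∣m∣n⇒∣m+n; ∣m+n∣m⇒∣n; ∣1⇒≡1; m∣m*n; *-monoˡ-∣; *-cancelʳ-∣)
open import Data.Nat.ListAction using (sum)
open import Data.Nat.Primality using (Prime; prime?; euclidsLemma; prime⇒nonZero)
open import Data.Nat.Properties
open import Algebra.Properties.CommutativeMonoid.Sum +-0-commutativeMonoid
  using (sum-syntax; sum-cong-≗; ∑-distrib-+; sum-replicate-zero)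
  renaming (sum to ∑)
open import Algebra.Properties.Semiring.Sum +-*-semiring using (*-distribˡ-sum; *-distribʳ-sum)
open import Data.Nat.Tactic.RingSolver using (solve-∀)
open import Data.Product using (_×_; _,_; ∃; ∃₂; proj₁; proj₂)
open import Data.Product.Properties using (≡-dec)
open import Data.Sum using (_⊎_; inj₁; inj₂)
open import Data.Vec using (Vec; _∷_; []; lookup)
open import Function using (_∘_; id)
open import Function.Bundles using (_⇔_; mk⇔)
open import Relation.Binary.Definitions using (tri<; tri≈; tri>)
open import Relation.Binary.PropositionalEquality
open import Relation.Nullary using (Dec; yes; no; ¬_; ¬?; contradiction)
open import Relation.Nullary.Decidable using (True; ⌊_⌋; toWitness; _×-dec_; _⊎-dec_; _→-dec_)

bit : Bool → ℕ
bit true  = 1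
bit false = 0

bit-∧ : ∀ p q → bit (p ∧ q) ≡ bit p * bit q
bit-∧ true  q = sym (+-identityʳ (bit q))
bit-∧ false q = refl

bit-∨-disjoint : ∀ p q → p ∧ q ≡ false → bit (p ∨ q) ≡ bit p + bit q
bit-∨-disjoint true  false _ = refl
bit-∨-disjoint false q     _ = refl

δ : ∀ {n} → Fin n → Fin n → ℕ
δ x y = bit ⌊ x F.≟ y ⌋

δ-sym : ∀ {n} (x y : Fin n) → δ x y ≡ δ y x
δ-sym x y with x F.≟ y | y F.≟ x
... | yes _    | yes _    = refl
... | no _     | no _     = refl
... | yes refl | no y≢x   = ⊥-elim (y≢x refl)
... | no x≢y   | yes refl = ⊥-elim (x≢y refl)

δ-suc : ∀ {n} (x y : Fin n) → δ (suc x) (suc y) ≡ δ x y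
δ-suc x y with x F.≟ y
... | yes _ = refl
... | no _  = refl

≟-image : ∀ {m n} (φ : Fin m → Fin n) → (∀ a b → φ a ≡ φ b → a ≡ b) → ∀ a w → ⌊ φ a F.≟ φ w ⌋ ≡ ⌊ a F.≟ w ⌋
≟-image φ φ-inj a w with φ a F.≟ φ w | a F.≟ w
... | yes _     | yes _    = refl
... | no _      | no _     = refl
... | yes φa≡φw | no a≢w   = ⊥-elim (a≢w (φ-inj a w φa≡φw))
... | no φa≢φw  | yes refl = ⊥-elim (φa≢φw refl)

δ-image : ∀ {m n} (φ : Fin m → Fin n) → (∀ a b → φ a ≡ φ b → a ≡ b) → ∀ a w → δ (φ a) (φ w) ≡ δ a w
δ-image φ φ-inj a w = cong bit (≟-image φ φ-inj a w)

δ-≢ : ∀ {n} {x y : Fin n} → x ≢ y → δ x y ≡ 0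
δ-≢ {x = x} {y} x≢y with x F.≟ y
... | yes x≡y = ⊥-elim (x≢y x≡y)
... | no _    = refl

≟-refl : ∀ {n} (x : Fin n) → ⌊ x F.≟ x ⌋ ≡ true
≟-refl x with x F.≟ x
... | yes _  = refl
... | no x≢x = ⊥-elim (x≢x refl)

∑-δ : ∀ {n} (p : Fin n) → ∑[ x < n ] δ p x ≡ 1
∑-δ {suc n} zero    = cong suc (sum-replicate-zero n)
∑-δ {suc n} (suc p) = trans (sum-cong-≗ (δ-suc p)) (∑-δ p)

∑-δ′ : ∀ {n} (p : Fin n) → ∑[ x < n ] δ x p ≡ 1
∑-δ′ p = trans (sum-cong-≗ (λ x → δ-sym x p)) (∑-δ p)

∑-const : ∀ n k → ∑[ x < n ] k ≡ n * k
∑-const zero    k = refl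
∑-const (suc n) k = cong (k +_) (∑-const n k)

sum-map-cong : ∀ {A : Set} (L : List A) {f g : A → ℕ} →
               (∀ {a} → a ∈ L → f a ≡ g a) → sum (map f L) ≡ sum (map g L)
sum-map-cong []      f≡g = refl
sum-map-cong (a ∷ L) f≡g = cong₂ _+_ (f≡g (here refl)) (sum-map-cong L (f≡g ∘ there))

sum-map-const : ∀ {A : Set} (L : List A) k → sum (map (λ _ → k) L) ≡ length L * k
sum-map-const []      k = refl
sum-map-const (a ∷ L) k = cong (k +_) (sum-map-const L k)

length-filterᵇ : ∀ {A : Set} (p : A → Bool) (L : List A) →
                 length (filterᵇ p L) ≡ sum (map (λ a → bit (p a)) L)
length-filterᵇ p []      = refl
length-filterᵇ p (a ∷ L) with p a
... | true  = cong suc (length-filterᵇ p L)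
... | false = length-filterᵇ p L

∑-sum-comm : ∀ n {A : Set} (L : List A) (f : A → Fin n → ℕ) →
             ∑[ x < n ] sum (map (λ a → f a x) L) ≡ sum (map (λ a → ∑[ x < n ] f a x) L)
∑-sum-comm n []      f = sum-replicate-zero n
∑-sum-comm n (a ∷ L) f =
  trans (∑-distrib-+ (f a) (λ x → sum (map (λ b → f b x) L))) (cong (∑ (f a) +_) (∑-sum-comm n L f))

crossed-disjoint : ∀ {n} {a b : Fin n} (x y : Fin n) → a ≢ b →
  (⌊ a F.≟ x ⌋ ∧ ⌊ b F.≟ y ⌋) ∧ (⌊ a F.≟ y ⌋ ∧ ⌊ b F.≟ x ⌋) ≡ false
crossed-disjoint {a = a} {b} x y a≢b with a F.≟ x | b F.≟ x
... | yes refl | yes refl = ⊥-elim (a≢b refl)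
... | yes _    | no _     = trans (cong (⌊ b F.≟ y ⌋ ∧_) (∧-zeroʳ ⌊ a F.≟ y ⌋)) (∧-zeroʳ _)
... | no _     | _        = refl

module _ {v n} (φ : Fin v → Fin n) {a b : Fin v} (φa≢φb : φ a ≢ φ b) where

  hits-split : ∀ x y → bit (hitsᵇ φ x y (a , b)) ≡ δ (φ a) x * δ (φ b) y + δ (φ a) y * δ (φ b) x
  hits-split x y = begin
    bit (hitsᵇ φ x y (a , b))
      ≡⟨ bit-∨-disjoint (⌊ φ a F.≟ x ⌋ ∧ ⌊ φ b F.≟ y ⌋) (⌊ φ a F.≟ y ⌋ ∧ ⌊ φ b F.≟ x ⌋)
                        (crossed-disjoint x y φa≢φb) ⟩
    bit (⌊ φ a F.≟ x ⌋ ∧ ⌊ φ b F.≟ y ⌋) + bit (⌊ φ a F.≟ y ⌋ ∧ ⌊ φ b F.≟ x ⌋)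
      ≡⟨ cong₂ _+_ (bit-∧ ⌊ φ a F.≟ x ⌋ _) (bit-∧ ⌊ φ a F.≟ y ⌋ _) ⟩
    δ (φ a) x * δ (φ b) y + δ (φ a) y * δ (φ b) x ∎
    where open ≡-Reasoning

  ∑-hits-row : ∀ z → ∑[ y < n ] bit (hitsᵇ φ z y (a , b)) ≡ δ (φ a) z + δ (φ b) z
  ∑-hits-row z = begin
    ∑[ y < n ] bit (hitsᵇ φ z y (a , b))
      ≡⟨ sum-cong-≗ (hits-split z) ⟩
    ∑[ y < n ] (δ (φ a) z * δ (φ b) y + δ (φ a) y * δ (φ b) z)
      ≡⟨ ∑-distrib-+ (λ y → δ (φ a) z * δ (φ b) y) (λ y → δ (φ a) y * δ (φ b) z) ⟩
    ∑[ y < n ] (δ (φ a) z * δ (φ b) y) + ∑[ y < n ] (δ (φ a) y * δ (φ b) z)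
      ≡˘⟨ cong₂ _+_ (*-distribˡ-sum (δ (φ a) z) (δ (φ b))) (*-distribʳ-sum (δ (φ b) z) (δ (φ a))) ⟩
    δ (φ a) z * ∑[ y < n ] δ (φ b) y + ∑[ y < n ] δ (φ a) y * δ (φ b) z
      ≡⟨ cong₂ _+_ (cong (δ (φ a) z *_) (∑-δ (φ b))) (cong (_* δ (φ b) z) (∑-δ (φ a))) ⟩
    δ (φ a) z * 1 + 1 * δ (φ b) z
      ≡⟨ cong₂ _+_ (*-identityʳ (δ (φ a) z)) (*-identityˡ (δ (φ b) z)) ⟩
    δ (φ a) z + δ (φ b) z ∎
    where open ≡-Reasoning

  ∑∑-hits : ∑[ x < n ] ∑[ y < n ] bit (hitsᵇ φ x y (a , b)) ≡ 2
  ∑∑-hits = begin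
    ∑[ x < n ] ∑[ y < n ] bit (hitsᵇ φ x y (a , b))
      ≡⟨ sum-cong-≗ ∑-hits-row ⟩
    ∑[ x < n ] (δ (φ a) x + δ (φ b) x)
      ≡⟨ ∑-distrib-+ (δ (φ a)) (δ (φ b)) ⟩
    ∑[ x < n ] δ (φ a) x + ∑[ x < n ] δ (φ b) x
      ≡⟨ cong₂ _+_ (∑-δ (φ a)) (∑-δ (φ b)) ⟩
    2 ∎
    where open ≡-Reasoning

  hits-diagonal : ∀ x → hitsᵇ φ x x (a , b) ≡ false
  hits-diagonal x with φ a F.≟ x | φ b F.≟ x
  ... | yes φa≡x | yes φb≡x = ⊥-elim (φa≢φb (trans φa≡x (sym φb≡x)))
  ... | yes _    | no _     = refl
  ... | no _     | _        = refl

hits-sym : ∀ {v n} (φ : Fin v → Fin n) x y e → hitsᵇ φ x y e ≡ hitsᵇ φ y x e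
hits-sym φ x y (a , b) = ∨-comm (⌊ φ a F.≟ x ⌋ ∧ ⌊ φ b F.≟ y ⌋) _

-- Counting the edges covered by copies of a graph

Loopless : ∀ {v} → Graph v → Set
Loopless G = ∀ {a b} → (a , b) ∈ G → a ≢ b

AllInjective : ∀ {v n} → List (Fin v → Fin n) → Set
AllInjective D = ∀ {φ} → φ ∈ D → ∀ a b → φ a ≡ φ b → a ≡ b

degree : ∀ {v} → Graph v → Fin v → ℕ
degree G w = sum (map (λ (a , b) → δ a w + δ b w) G)

completeAdj : ∀ {n} → Fin n → Fin n → ℕ
completeAdj x y = bit (not ⌊ x F.≟ y ⌋)

completeAdj-≢ : ∀ {n} {x y : Fin n} → x ≢ y → completeAdj x y ≡ 1
completeAdj-≢ {x = x} {y} x≢y with x F.≟ y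
... | yes x≡y = ⊥-elim (x≢y x≡y)
... | no _    = refl

completeAdj-refl : ∀ {n} (x : Fin n) → completeAdj x x ≡ 0
completeAdj-refl x with x F.≟ x
... | yes _   = refl
... | no x≢x  = ⊥-elim (x≢x refl)

completeAdj+δ : ∀ {n} (x y : Fin n) → completeAdj x y + δ y x ≡ 1
completeAdj+δ x y with x F.≟ y | y F.≟ x
... | yes _    | yes _    = refl
... | no _     | no _     = refl
... | yes refl | no y≢x   = ⊥-elim (y≢x refl)
... | no x≢y   | yes refl = ⊥-elim (x≢y refl)

∑-completeAdj : ∀ n (x : Fin n) → ∑[ y < n ] completeAdj x y ≡ n ∸ 1
∑-completeAdj n x = begin
  ∑[ y < n ] completeAdj x y                                ≡˘⟨ m+n∸n≡m _ 1 ⟩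
  ∑[ y < n ] completeAdj x y + 1 ∸ 1                        ≡˘⟨ cong (λ t → ∑[ y < n ] completeAdj x y + t ∸ 1) (∑-δ′ x) ⟩
  ∑[ y < n ] completeAdj x y + ∑[ y < n ] δ y x ∸ 1        ≡˘⟨ cong (_∸ 1) (∑-distrib-+ (completeAdj x) (λ y → δ y x)) ⟩
  ∑[ y < n ] (completeAdj x y + δ y x) ∸ 1                  ≡⟨ cong (_∸ 1) (sum-cong-≗ (completeAdj+δ x)) ⟩
  ∑[ y < n ] 1 ∸ 1                                          ≡⟨ cong (_∸ 1) (trans (∑-const n 1) (*-identityʳ n)) ⟩
  n ∸ 1 ∎
  where open ≡-Reasoning

∑∑-completeAdj : ∀ n → ∑[ x < n ] ∑[ y < n ] completeAdj x y ≡ n * (n ∸ 1)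
∑∑-completeAdj n = trans (sum-cong-≗ (∑-completeAdj n)) (∑-const n (n ∸ 1))

∑-mono-≤ : ∀ n {f g : Fin n → ℕ} → (∀ x → f x ≤ g x) → ∑[ x < n ] f x ≤ ∑[ x < n ] g x
∑-mono-≤ zero    f≤g = z≤n
∑-mono-≤ (suc n) f≤g = +-mono-≤ (f≤g zero) (∑-mono-≤ n (f≤g ∘ suc))

∑-squeeze : ∀ n {f g : Fin n → ℕ} → (∀ x → f x ≤ g x) →
        ∑[ x < n ] f x ≡ ∑[ x < n ] g x → ∀ x → f x ≡ g x
∑-squeeze (suc n) {f} {g} f≤g ∑f≡∑g = pointwise
  where
  head≡ : f zero ≡ g zero
  head≡ = ≤-antisym (f≤g zero) (+-cancelʳ-≤ (∑[ x < n ] f (suc x)) (g zero) (f zero) (begin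
    g zero + ∑[ x < n ] f (suc x) ≤⟨ +-monoʳ-≤ (g zero) (∑-mono-≤ n (f≤g ∘ suc)) ⟩
    g zero + ∑[ x < n ] g (suc x) ≡⟨ sym ∑f≡∑g ⟩
    f zero + ∑[ x < n ] f (suc x) ∎))
    where open ≤-Reasoning
  pointwise : ∀ x → f x ≡ g x
  pointwise zero    = head≡
  pointwise (suc x) = ∑-squeeze n (f≤g ∘ suc) (+-cancelˡ-≡ (f zero) _ _ (trans ∑f≡∑g (cong (_+ _) (sym head≡)))) x

sum-∣ : ∀ {A : Set} {d} (L : List A) (f : A → ℕ) → (∀ {a} → a ∈ L → d ∣ f a) → d ∣ sum (map f L)
sum-∣ []      f d∣f = _ ∣0
sum-∣ (a ∷ L) f d∣f = ∣m∣n⇒∣m+n (d∣f (here refl)) (sum-∣ L f (d∣f ∘ there))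

module _ {v} (G : Graph v) where

  edgeHits : ∀ {n} → (Fin v → Fin n) → Fin n → Fin n → ℕ
  edgeHits φ x y = sum (map (λ e → bit (hitsᵇ φ x y e)) G)

  coverCount≡∑edgeHits : ∀ {n} (D : List (Fin v → Fin n)) x y →
                         coverCount G D x y ≡ sum (map (λ φ → edgeHits φ x y) D)
  coverCount≡∑edgeHits D x y = sum-map-cong D (λ {φ} _ → length-filterᵇ (hitsᵇ φ x y) G)

  coverCount-sym : ∀ {n} (D : List (Fin v → Fin n)) x y → coverCount G D x y ≡ coverCount G D y x
  coverCount-sym D x y = begin
    coverCount G D x y                   ≡⟨ coverCount≡∑edgeHits D x y ⟩
    sum (map (λ φ → edgeHits φ x y) D)   ≡⟨ sum-map-cong D (λ {φ} _ → sum-map-cong G (λ {e} _ → cong bit (hits-sym φ x y e))) ⟩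
    sum (map (λ φ → edgeHits φ y x) D)   ≡˘⟨ coverCount≡∑edgeHits D y x ⟩
    coverCount G D y x                   ∎
    where open ≡-Reasoning

module Counting {v} (G : Graph v) (loopless : Loopless G) where

  private
    separates : ∀ {n} {φ : Fin v → Fin n} → (∀ a b → φ a ≡ φ b → a ≡ b) →
                ∀ {a b} → (a , b) ∈ G → φ a ≢ φ b
    separates φ-inj {a} {b} ab∈G φa≡φb = loopless ab∈G (φ-inj a b φa≡φb)

  ∑∑-edgeHits : ∀ {n} (φ : Fin v → Fin n) → (∀ a b → φ a ≡ φ b → a ≡ b) →
                ∑[ x < n ] ∑[ y < n ] edgeHits G φ x y ≡ length G * 2
  ∑∑-edgeHits {n} φ φ-inj = begin
    ∑[ x < n ] ∑[ y < n ] sum (map (λ e → bit (hitsᵇ φ x y e)) G)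
      ≡⟨ sum-cong-≗ (λ x → ∑-sum-comm n G (λ e y → bit (hitsᵇ φ x y e))) ⟩
    ∑[ x < n ] sum (map (λ e → ∑[ y < n ] bit (hitsᵇ φ x y e)) G)
      ≡⟨ ∑-sum-comm n G (λ e x → ∑[ y < n ] bit (hitsᵇ φ x y e)) ⟩
    sum (map (λ e → ∑[ x < n ] ∑[ y < n ] bit (hitsᵇ φ x y e)) G)
      ≡⟨ sum-map-cong G (λ { {a , b} ab∈G → ∑∑-hits φ (separates φ-inj ab∈G) }) ⟩
    sum (map (λ _ → 2) G)
      ≡⟨ sum-map-const G 2 ⟩
    length G * 2 ∎
    where open ≡-Reasoning

  ∑∑-coverCount : ∀ {n} (D : List (Fin v → Fin n)) → AllInjective D →
                  ∑[ x < n ] ∑[ y < n ] coverCount G D x y ≡ length D * (length G * 2)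
  ∑∑-coverCount {n} D D-inj = begin
    ∑[ x < n ] ∑[ y < n ] coverCount G D x y
      ≡⟨ sum-cong-≗ (λ x → sum-cong-≗ (coverCount≡∑edgeHits G D x)) ⟩
    ∑[ x < n ] ∑[ y < n ] sum (map (λ φ → edgeHits G φ x y) D)
      ≡⟨ sum-cong-≗ (λ x → ∑-sum-comm n D (λ φ y → edgeHits G φ x y)) ⟩
    ∑[ x < n ] sum (map (λ φ → ∑[ y < n ] edgeHits G φ x y) D)
      ≡⟨ ∑-sum-comm n D (λ φ x → ∑[ y < n ] edgeHits G φ x y) ⟩
    sum (map (λ φ → ∑[ x < n ] ∑[ y < n ] edgeHits G φ x y) D)
      ≡⟨ sum-map-cong D (λ {φ} φ∈D → ∑∑-edgeHits φ (D-inj φ∈D)) ⟩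
    sum (map (λ _ → length G * 2) D)
      ≡⟨ sum-map-const D _ ⟩
    length D * (length G * 2) ∎
    where open ≡-Reasoning

  coverCount-diagonal : ∀ {n} (D : List (Fin v → Fin n)) → AllInjective D → ∀ x → coverCount G D x x ≡ 0
  coverCount-diagonal D D-inj x = begin
    coverCount G D x x                     ≡⟨ coverCount≡∑edgeHits G D x x ⟩
    sum (map (λ φ → edgeHits G φ x x) D)   ≡⟨ sum-map-cong D (λ {φ} φ∈D → no-hits φ (D-inj φ∈D)) ⟩
    sum (map (λ _ → 0) D)                  ≡⟨ sum-map-const D 0 ⟩
    length D * 0                           ≡⟨ *-zeroʳ (length D) ⟩
    0                                      ∎
    where
    open ≡-Reasoning
    no-hits : ∀ φ → (∀ a b → φ a ≡ φ b → a ≡ b) → edgeHits G φ x x ≡ 0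
    no-hits φ φ-inj = trans (sum-map-cong G (λ { {a , b} ab∈G → cong bit (hits-diagonal φ (separates φ-inj ab∈G) x) }))
                            (trans (sum-map-const G 0) (*-zeroʳ (length G)))

  incidence : ∀ {n} → (Fin v → Fin n) → Fin n → ℕ
  incidence φ z = sum (map (λ (a , b) → δ (φ a) z + δ (φ b) z) G)

  ∑-coverCount-row : ∀ {n} (D : List (Fin v → Fin n)) → AllInjective D → ∀ z →
                     ∑[ y < n ] coverCount G D z y ≡ sum (map (λ φ → incidence φ z) D)
  ∑-coverCount-row {n} D D-inj z = begin
    ∑[ y < n ] coverCount G D z y
      ≡⟨ sum-cong-≗ (coverCount≡∑edgeHits G D z) ⟩
    ∑[ y < n ] sum (map (λ φ → edgeHits G φ z y) D)
      ≡⟨ ∑-sum-comm n D (λ φ y → edgeHits G φ z y) ⟩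
    sum (map (λ φ → ∑[ y < n ] edgeHits G φ z y) D)
      ≡⟨ sum-map-cong D (λ {φ} φ∈D → trans (∑-sum-comm n G (λ e y → bit (hitsᵇ φ z y e)))
           (sum-map-cong G (λ { {a , b} ab∈G → ∑-hits-row φ (separates (D-inj φ∈D) ab∈G) z }))) ⟩
    sum (map (λ φ → incidence φ z) D) ∎
    where open ≡-Reasoning

  incidence-∣ : ∀ {n d} (φ : Fin v → Fin n) → (∀ a b → φ a ≡ φ b → a ≡ b) →
                (∀ w → d ∣ degree G w) → ∀ z → d ∣ incidence φ z
  incidence-∣ φ φ-inj d∣deg z with FP.any? (λ w → φ w F.≟ z)
  ... | yes (w , refl) = subst (_ ∣_) (sum-map-cong G (λ { {a , b} _ →
                           sym (cong₂ _+_ (δ-image φ φ-inj a w) (δ-image φ φ-inj b w)) })) (d∣deg w)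
  ... | no z∉φ = subst (_ ∣_) (sym (trans (sum-map-cong G (λ { {a , b} _ →
                   cong₂ _+_ (δ-≢ (z∉φ ∘ (a ,_))) (δ-≢ (z∉φ ∘ (b ,_))) })) (trans (sum-map-const G 0) (*-zeroʳ (length G)))))
                   (_ ∣0)

  module _ {n} {D : List (Fin v → Fin n)} (design : IsDesign G n D) where
    open IsDesign design

    coverCount-design : ∀ x y → coverCount G D x y ≡ completeAdj x y
    coverCount-design x y with FP.<-cmp x y
    ... | tri< x<y x≢y _ = trans (partition x y x<y) (sym (completeAdj-≢ x≢y))
    ... | tri≈ _ refl _  = trans (coverCount-diagonal D injective x) (sym (completeAdj-refl x))
    ... | tri> _ x≢y y<x = trans (coverCount-sym G D x y) (trans (partition y x y<x) (sym (completeAdj-≢ x≢y)))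

    design-size : length D * (length G * 2) ≡ n * (n ∸ 1)
    design-size = begin
      length D * (length G * 2)                    ≡˘⟨ ∑∑-coverCount D injective ⟩
      ∑[ x < n ] ∑[ y < n ] coverCount G D x y     ≡⟨ sum-cong-≗ (λ x → sum-cong-≗ (coverCount-design x)) ⟩
      ∑[ x < n ] ∑[ y < n ] completeAdj x y        ≡⟨ ∑∑-completeAdj n ⟩
      n * (n ∸ 1)                                  ∎
      where open ≡-Reasoning

    degree-∣-order : ∀ {d} → (∀ w → d ∣ degree G w) → (z : Fin n) → d ∣ n ∸ 1
    degree-∣-order d∣deg z = subst (_ ∣_) row-sum
      (sum-∣ D (λ φ → incidence φ z) (λ φ∈D → incidence-∣ _ (injective φ∈D) d∣deg z))
      where
      row-sum : sum (map (λ φ → incidence φ z) D) ≡ n ∸ 1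
      row-sum = trans (sym (∑-coverCount-row D injective z))
                      (trans (sum-cong-≗ (coverCount-design z)) (∑-completeAdj n z))

  isDesign-by-counting : ∀ {n} (D : List (Fin v → Fin n)) → AllInjective D →
                         length D * (length G * 2) ≡ n * (n ∸ 1) →
                         (∀ x y → x F.< y → 1 ≤ coverCount G D x y) → IsDesign G n D
  isDesign-by-counting {n} D D-inj size covered = record { injective = D-inj ; partition = exactly-once }
    where
    completeAdj≤coverCount : ∀ x y → completeAdj x y ≤ coverCount G D x y
    completeAdj≤coverCount x y with FP.<-cmp x y
    ... | tri< x<y x≢y _ = subst (_≤ coverCount G D x y) (sym (completeAdj-≢ x≢y)) (covered x y x<y)
    ... | tri≈ _ refl _  = subst (_≤ coverCount G D x x) (sym (completeAdj-refl x)) z≤n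
    ... | tri> _ x≢y y<x = subst₂ _≤_ (sym (completeAdj-≢ x≢y)) (coverCount-sym G D y x) (covered y x y<x)
    ∑∑-equal : ∑[ x < n ] ∑[ y < n ] completeAdj x y ≡ ∑[ x < n ] ∑[ y < n ] coverCount G D x y
    ∑∑-equal = trans (∑∑-completeAdj n) (trans (sym size) (sym (∑∑-coverCount D D-inj)))
    rows-equal : ∀ x → ∑[ y < n ] completeAdj x y ≡ ∑[ y < n ] coverCount G D x y
    rows-equal = ∑-squeeze n (λ x → ∑-mono-≤ n (completeAdj≤coverCount x)) ∑∑-equal
    exactly-once : ∀ x y → x F.< y → coverCount G D x y ≡ 1
    exactly-once x y x<y = trans (sym (∑-squeeze n (completeAdj≤coverCount x) (rows-equal x) y))
                                 (completeAdj-≢ (FP.<⇒≢ x<y))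

EdgeIn : ∀ {v} → Graph v → Fin v → Fin v → Set
EdgeIn G lo hi = (lo , hi) ∈ G ⊎ (hi , lo) ∈ G

≤-sum-map : ∀ {A : Set} (L : List A) (f : A → ℕ) {a} → a ∈ L → f a ≤ sum (map f L)
≤-sum-map (b ∷ L) f (here refl) = m≤m+n (f b) _
≤-sum-map (b ∷ L) f (there a∈L) = ≤-trans (≤-sum-map L f a∈L) (m≤n+m _ (f b))

positive-summand : ∀ {A : Set} (L : List A) (f : A → ℕ) → 1 ≤ sum (map f L) → ∃ λ a → a ∈ L × 1 ≤ f a
positive-summand (a ∷ L) f 1≤sum with f a in fa≡
... | suc _ = a , here refl , subst (1 ≤_) (sym fa≡) (s≤s z≤n)
... | zero with positive-summand L f 1≤sum
...   | b , b∈L , 1≤fb = b , there b∈L , 1≤fb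

hits-covered : ∀ {v n} {G : Graph v} {D : List (Fin v → Fin n)} {φ e x y} →
               φ ∈ D → e ∈ G → T (hitsᵇ φ x y e) → 1 ≤ coverCount G D x y
hits-covered {G = G} {D} {φ} {e} {x} {y} φ∈D e∈G hit =
  ≤-trans (one-in-filter (∈-filter⁺ (T? ∘ hitsᵇ φ x y) e∈G hit))
          (≤-sum-map D (λ ψ → length (filterᵇ (hitsᵇ ψ x y) G)) φ∈D)
  where
  one-in-filter : ∀ {A : Set} {a : A} {L} → a ∈ L → 1 ≤ length L
  one-in-filter {L = _ ∷ _} _ = s≤s z≤n

covered-hits : ∀ {v n} (G : Graph v) (D : List (Fin v → Fin n)) {x y} → 1 ≤ coverCount G D x y →
               ∃ λ φ → φ ∈ D × ∃ λ e → e ∈ G × T (hitsᵇ φ x y e)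
covered-hits G D {x} {y} 1≤count with positive-summand D _ 1≤count
... | φ , φ∈D , 1≤len = φ , φ∈D , first-of-filter 1≤len
  where
  first-of-filter : ∀ {L} → 1 ≤ length (filterᵇ (hitsᵇ φ x y) L) → ∃ λ e → e ∈ L × T (hitsᵇ φ x y e)
  first-of-filter {L} 1≤len with filterᵇ (hitsᵇ φ x y) L in filtered
  ... | e ∷ _ = e , ∈-filter⁻ (T? ∘ hitsᵇ φ x y) (subst (e ∈_) (sym filtered) (here refl))

edge-covered : ∀ {v n} {G : Graph v} {D : List (Fin v → Fin n)} {φ lo hi} →
               φ ∈ D → EdgeIn G lo hi → 1 ≤ coverCount G D (φ lo) (φ hi)
edge-covered {φ = φ} {lo} {hi} φ∈D (inj₁ e∈G) = hits-covered φ∈D e∈G hit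
  where
  hit : T (hitsᵇ φ (φ lo) (φ hi) (lo , hi))
  hit rewrite ≟-refl (φ lo) | ≟-refl (φ hi) = _
edge-covered {φ = φ} {lo} {hi} φ∈D (inj₂ e∈G) = hits-covered φ∈D e∈G hit
  where
  hit : T (hitsᵇ φ (φ lo) (φ hi) (hi , lo))
  hit rewrite ≟-refl (φ lo) | ≟-refl (φ hi) | ∨-zeroʳ (⌊ φ hi F.≟ φ lo ⌋ ∧ ⌊ φ lo F.≟ φ hi ⌋) = _

hits-image : ∀ {v m n} (ψ : Fin m → Fin n) → (∀ a b → ψ a ≡ ψ b → a ≡ b) →
             (β : Fin v → Fin m) → ∀ x y e → hitsᵇ (ψ ∘ β) (ψ x) (ψ y) e ≡ hitsᵇ β x y e
hits-image ψ ψ-inj β x y (a , b) =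
  cong₂ _∨_ (cong₂ _∧_ (≟-image ψ ψ-inj (β a) x) (≟-image ψ ψ-inj (β b) y))
            (cong₂ _∧_ (≟-image ψ ψ-inj (β a) y) (≟-image ψ ψ-inj (β b) x))

-- Necessity

prime^-∣-cancelˡ : ∀ {p} → Prime p → ∀ k {a b} → ¬ p ∣ a → p ^ k ∣ a * b → p ^ k ∣ b
prime^-∣-cancelˡ pp zero          _   _       = 1∣ _
prime^-∣-cancelˡ {p} pp (suc k) {a} {b} p∤a p^k+1∣ab
  with euclidsLemma a b pp (∣-trans (m∣m*n (p ^ k)) p^k+1∣ab)
... | inj₁ p∣a = contradiction p∣a p∤a
... | inj₂ (divides c refl) = subst (_∣ c * p) (*-comm (p ^ k) p) (*-monoˡ-∣ p p^k∣c)
  where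
  instance _ = prime⇒nonZero pp
  p^k∣c : p ^ k ∣ c
  p^k∣c = prime^-∣-cancelˡ pp k p∤a (*-cancelʳ-∣ p (subst₂ _∣_ (*-comm p (p ^ k)) (sym (*-assoc a c p)) p^k+1∣ab))

∣m⇒∤suc-m : ∀ {d m} → 1 < d → d ∣ m → ¬ d ∣ suc m
∣m⇒∤suc-m {d} {m} 1<d d∣m d∣suc-m =
  >⇒≢ 1<d (∣1⇒≡1 (∣m+n∣m⇒∣n (subst (d ∣_) (+-comm 1 m) d∣suc-m) d∣m))

order≡1-mod-27 : ∀ {m} → 3 ∣ m → 27 ∣ suc m * m → suc m % 27 ≡ 1
order≡1-mod-27 {m} 3∣m 27∣n[n-1]
  with prime^-∣-cancelˡ (toWitness {a? = prime? 3} _) 3 (∣m⇒∤suc-m (s≤s (s≤s z≤n)) 3∣m) 27∣n[n-1]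
... | divides q refl = [m+kn]%n≡m%n 1 q 27

∈-concatMap⁺′ : ∀ {I X : Set} (f : I → List X) {is i x} → i ∈ is → x ∈ f i → x ∈ concatMap f is
∈-concatMap⁺′ f i∈is x∈fi = ∈-concatMap⁺ f (lose i∈is x∈fi)

∈-concatMap⁻′ : ∀ {I X : Set} (f : I → List X) is {x} → x ∈ concatMap f is → ∃ λ i → i ∈ is × x ∈ f i
∈-concatMap⁻′ f is x∈ = find (∈-concatMap⁻ f {xs = is} x∈)

length-concatMap : ∀ {I X : Set} (f : I → List X) is {c} → (∀ i → length (f i) ≡ c) →
                   length (concatMap f is) ≡ length is * c
length-concatMap f []       len-f = refl
length-concatMap f (i ∷ is) len-f = trans (length-++ (f i)) (cong₂ _+_ (len-f i) (length-concatMap f is len-f))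

%-cancelˡ-+ : ∀ s {a b} n .{{_ : NonZero n}} → (s + a) % n ≡ (s + b) % n → a % n ≡ b % n
%-cancelˡ-+ s {a} {b} n eq = begin
  a % n                              ≡˘⟨ [m+kn]%n≡m%n a (suc (s / n)) n ⟩
  (a + suc (s / n) * n) % n          ≡⟨ cong (_% n) (shift a) ⟩
  (u + (s + a)) % n                  ≡⟨ %-distribˡ-+ u (s + a) n ⟩
  (u % n + (s + a) % n) % n          ≡⟨ cong (λ z → (u % n + z) % n) eq ⟩
  (u % n + (s + b) % n) % n          ≡˘⟨ %-distribˡ-+ u (s + b) n ⟩
  (u + (s + b)) % n                  ≡˘⟨ cong (_% n) (shift b) ⟩
  (b + suc (s / n) * n) % n          ≡⟨ [m+kn]%n≡m%n b (suc (s / n)) n ⟩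
  b % n                              ∎
  where
  open ≡-Reasoning
  u = n ∸ s % n
  -- u + s ≡ 0 (mod n): adding u undoes the translation by s.
  u+s : u + s ≡ suc (s / n) * n
  u+s = begin
    n ∸ s % n + s                      ≡⟨ cong (n ∸ s % n +_) (m≡m%n+[m/n]*n s n) ⟩
    n ∸ s % n + (s % n + s / n * n)    ≡˘⟨ +-assoc (n ∸ s % n) (s % n) _ ⟩
    n ∸ s % n + s % n + s / n * n      ≡⟨ cong (_+ s / n * n) (m∸n+n≡m (m%n≤n s n)) ⟩
    n + s / n * n                      ∎
  shift : ∀ a → a + suc (s / n) * n ≡ u + (s + a)
  shift a = trans (+-comm a _) (trans (cong (_+ a) (sym u+s)) (+-assoc u s a))

+-%-injective : ∀ s {a b} n .{{_ : NonZero n}} → a < n → b < n → (s + a) % n ≡ (s + b) % n → a ≡ b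
+-%-injective s {a} {b} n a<n b<n eq =
  trans (sym (m<n⇒m%n≡m a<n)) (trans (%-cancelˡ-+ s n eq) (m<n⇒m%n≡m b<n))

%-congˡ-+ : ∀ a b c n .{{_ : NonZero n}} → a % n ≡ b % n → (a + c) % n ≡ (b + c) % n
%-congˡ-+ a b c n eq =
  trans (%-distribˡ-+ a c n) (trans (cong (λ z → (z + c % n) % n) eq) (sym (%-distribˡ-+ b c n)))

[m+[n∸k]]%n+k : ∀ m {k} n .{{_ : NonZero n}} → k ≤ n → m < n → ((m + (n ∸ k)) % n + k) % n ≡ m
[m+[n∸k]]%n+k m {k} n k≤n m<n = begin
  ((m + (n ∸ k)) % n + k) % n    ≡⟨ %-congˡ-+ ((m + (n ∸ k)) % n) (m + (n ∸ k)) k n (m%n%n≡m%n (m + (n ∸ k)) n) ⟩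
  (m + (n ∸ k) + k) % n          ≡⟨ cong (_% n) (trans (+-assoc m (n ∸ k) k) (cong (m +_) (m∸n+n≡m k≤n))) ⟩
  (m + n) % n                    ≡⟨ [m+n]%n≡m%n m n ⟩
  m % n                          ≡⟨ m<n⇒m%n≡m m<n ⟩
  m                              ∎
  where open ≡-Reasoning

toℕ-mod : ∀ {n} .{{_ : NonZero n}} m → toℕ (m mod n) ≡ m % n
toℕ-mod m = FP.toℕ-fromℕ< _

-- Cyclic designs of order 54K + 1

module CyclicFamily {v} (G : Graph v) (n : ℕ) .{{_ : NonZero n}} (K : ℕ) (L : ℕ → Fin v → ℕ)
                    (L<n : ∀ {i} → i < K → ∀ w → L i w < n) where

  translate : ℕ → ℕ → Fin v → Fin n
  translate i s w = (s + L i w) mod n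

  blocks : List (Fin v → Fin n)
  blocks = concatMap (λ i → applyUpTo (translate i) n) (upTo K)

  length-blocks : length blocks ≡ K * n
  length-blocks = trans (length-concatMap _ (upTo K) (λ i → length-applyUpTo (translate i) n))
                        (cong (_* n) (length-upTo K))

  blocks-injective : (∀ {i} → i < K → ∀ a b → L i a ≡ L i b → a ≡ b) → AllInjective blocks
  blocks-injective L-inj φ∈ with ∈-concatMap⁻′ (λ i → applyUpTo (translate i) n) (upTo K) φ∈
  ... | i , i∈upTo , φ∈translates with ∈-upTo⁻ i∈upTo | ∈-applyUpTo⁻ (translate i) φ∈translates
  ...   | i<K | s , _ , refl = λ a b eq → L-inj i<K a b
            (+-%-injective s n (L<n i<K a) (L<n i<K b) (trans (sym (toℕ-mod _)) (trans (cong toℕ eq) (toℕ-mod _))))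

  translate-covers : ∀ {i lo hi D} → i < K → EdgeIn G lo hi → L i hi ≡ L i lo + D →
                     (x y : Fin n) → (toℕ x + D) % n ≡ toℕ y → 1 ≤ coverCount G blocks x y
  translate-covers {i} {lo} {hi} {D} i<K edge eqL x y x+D≡y =
    subst₂ (λ a b → 1 ≤ coverCount G blocks a b) lo↦x hi↦y (edge-covered φ∈blocks edge)
    where
    s = (toℕ x + (n ∸ L i lo)) % n
    φ∈blocks : translate i s ∈ blocks
    φ∈blocks = ∈-concatMap⁺′ _ (∈-upTo⁺ i<K) (∈-applyUpTo⁺ (translate i) (m%n<n _ n))
    s+Llo : (s + L i lo) % n ≡ toℕ x
    s+Llo = [m+[n∸k]]%n+k (toℕ x) n (<⇒≤ (L<n i<K lo)) (FP.toℕ<n x)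
    lo↦x : translate i s lo ≡ x
    lo↦x = FP.toℕ-injective (trans (toℕ-mod _) s+Llo)
    hi↦y : translate i s hi ≡ y
    hi↦y = FP.toℕ-injective (begin
      toℕ (translate i s hi)     ≡⟨ toℕ-mod _ ⟩
      (s + L i hi) % n           ≡⟨ cong (λ z → (s + z) % n) eqL ⟩
      (s + (L i lo + D)) % n     ≡˘⟨ cong (_% n) (+-assoc s (L i lo) D) ⟩
      (s + L i lo + D) % n       ≡⟨ %-congˡ-+ (s + L i lo) (toℕ x) D n (trans s+Llo (sym (m<n⇒m%n≡m (FP.toℕ<n x)))) ⟩
      (toℕ x + D) % n            ≡⟨ x+D≡y ⟩
      toℕ y                      ∎)
      where open ≡-Reasoning

  record Realises (d : ℕ) : Set where
    field
      {i}        : ℕ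
      {lo hi}    : Fin v
      D          : ℕ
      i<K        : i < K
      edge       : EdgeIn G lo hi
      difference : L i hi ≡ L i lo + D
      D≡±d       : D ≡ d ⊎ D + d ≡ n

  realises-complement : ∀ {d} → d ≤ n → Realises d → Realises (n ∸ d)
  realises-complement {d} d≤n r = record { D = D ; i<K = i<K ; edge = edge ; difference = difference
                                         ; D≡±d = complement D≡±d }
    where
    open Realises r
    complement : D ≡ d ⊎ D + d ≡ n → D ≡ n ∸ d ⊎ D + (n ∸ d) ≡ n
    complement (inj₁ D≡d)   = inj₂ (trans (cong (_+ (n ∸ d)) D≡d) (m+[n∸m]≡n d≤n))
    complement (inj₂ D+d≡n) = inj₁ (trans (sym (m+n∸n≡m D d)) (cong (_∸ d) D+d≡n))

  realised-covered : ∀ x y → x F.< y → Realises (toℕ y ∸ toℕ x) → 1 ≤ coverCount G blocks x y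
  realised-covered x y x<y r = by-sign D≡±d
    where
    open Realises r
    X+d≡Y : toℕ x + (toℕ y ∸ toℕ x) ≡ toℕ y
    X+d≡Y = m+[n∸m]≡n (<⇒≤ x<y)
    by-sign : D ≡ toℕ y ∸ toℕ x ⊎ D + (toℕ y ∸ toℕ x) ≡ n → 1 ≤ coverCount G blocks x y
    by-sign (inj₁ D≡d) = translate-covers i<K edge difference x y
      (trans (cong (λ z → (toℕ x + z) % n) D≡d) (trans (cong (_% n) X+d≡Y) (m<n⇒m%n≡m (FP.toℕ<n y))))
    by-sign (inj₂ D+d≡n) = subst (1 ≤_) (coverCount-sym G blocks y x) (translate-covers i<K edge difference y x
      (trans (cong (_% n) Y+D≡X+n) (trans ([m+n]%n≡m%n (toℕ x) n) (m<n⇒m%n≡m (FP.toℕ<n x)))))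
      where
      Y+D≡X+n : toℕ y + D ≡ toℕ x + n
      Y+D≡X+n = begin
        toℕ y + D                           ≡˘⟨ cong (_+ D) X+d≡Y ⟩
        toℕ x + (toℕ y ∸ toℕ x) + D         ≡⟨ +-assoc (toℕ x) _ D ⟩
        toℕ x + ((toℕ y ∸ toℕ x) + D)       ≡⟨ cong (toℕ x +_) (trans (+-comm _ D) D+d≡n) ⟩
        toℕ x + n                           ∎
        where open ≡-Reasoning

  covered-by-differences : (∀ d → 1 ≤ d → d < n → Realises d) → ∀ x y → x F.< y → 1 ≤ coverCount G blocks x y
  covered-by-differences realise x y x<y =
    realised-covered x y x<y (realise _ (m<n⇒0<n∸m x<y) (≤-<-trans (m∸n≤m (toℕ y) (toℕ x)) (FP.toℕ<n y)))

-- Block i maps w to f w + 27 i (c w), so an edge lo — hi has difference f hi − f lo + 27 i (c hi − c lo).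
-- The shapes realise the difference t = r + 1 + 27 (p + 2h) in block p + 2h, in block h, or as n − t in
-- block K − 1 − h.
Shape : ∀ {v} (f c : Fin v → ℕ) (r p : ℕ) (lo hi : Fin v) → Set
Shape f c r p lo hi =
    (c hi ≡ suc (c lo) × f hi ≡ f lo + suc r)
  ⊎ (c lo ≡ 0 × c hi ≡ 2 × f hi ≡ f lo + (suc r + 27 * p))
  ⊎ (c lo ≡ 0 × c hi ≡ 2 × f hi ≡ f lo + (55 ∸ (suc r + 27 * p)))

record CyclicLabelling {v} (G : Graph v) : Set where
  field
    f c                : Fin v → ℕ
    f≤54               : ∀ w → f w ≤ 54
    c≤2                : ∀ w → c w ≤ 2
    f-injective-mod-27 : ∀ a b → f a % 27 ≡ f b % 27 → a ≡ b
    shapes             : ∀ r p → r < 27 → p < 2 → ∃₂ λ lo hi → EdgeIn G lo hi × Shape f c r p lo hi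

module CyclicConstruction {v} (G : Graph v) (loopless : Loopless G) (size : length G ≡ 27)
                          (labelling : CyclicLabelling G) (k : ℕ) where
  open CyclicLabelling labelling

  K n : ℕ
  K = suc k
  n = suc (54 * K)

  L : ℕ → Fin v → ℕ
  L i w = f w + c w * (27 * i)

  L<n : ∀ {i} → i < K → ∀ w → L i w < n
  L<n {i} i<K w = s≤s (begin
    f w + c w * (27 * i)   ≤⟨ +-mono-≤ (f≤54 w) (*-monoˡ-≤ (27 * i) (c≤2 w)) ⟩
    54 + 2 * (27 * i)      ≡˘⟨ cong (54 +_) (*-assoc 2 27 i) ⟩
    54 + 54 * i            ≤⟨ +-monoʳ-≤ 54 (*-monoʳ-≤ 54 (s≤s⁻¹ i<K)) ⟩
    54 + 54 * k            ≡˘⟨ *-suc 54 k ⟩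
    54 * K                 ∎)
    where open ≤-Reasoning

  L-injective : ∀ {i} → i < K → ∀ a b → L i a ≡ L i b → a ≡ b
  L-injective {i} _ a b La≡Lb = f-injective-mod-27 a b (trans (sym (L%27 a)) (trans (cong (_% 27) La≡Lb) (L%27 b)))
    where
    L%27 : ∀ w → L i w % 27 ≡ f w % 27
    L%27 w = trans (cong (λ z → (f w + z) % 27) (rearrange (c w) i)) ([m+kn]%n≡m%n (f w) (c w * i) 27)
      where
      rearrange : ∀ x i → x * (27 * i) ≡ x * i * 27
      rearrange = solve-∀

  open CyclicFamily G n K L L<n

  realise-digits : ∀ r p h → r < 27 → p < 2 → p + h * 2 < K → Realises (suc (r + (p + h * 2) * 27))
  realise-digits r p h r<27 p<2 q<K = from-shape (shapes r p r<27 p<2)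
    where
    from-shape : (∃₂ λ lo hi → EdgeIn G lo hi × Shape f c r p lo hi) → Realises (suc (r + (p + h * 2) * 27))
    from-shape (lo , hi , edge , inj₁ (c-step , f-step)) = record
      { i = p + h * 2 ; D = suc (r + (p + h * 2) * 27) ; i<K = q<K ; edge = edge ; D≡±d = inj₁ refl
      ; difference = trans (cong₂ (λ x y → x + y * (27 * (p + h * 2))) f-step c-step) (within (f lo) (c lo) r (p + h * 2)) }
      where
      within : ∀ x y r q → x + suc r + suc y * (27 * q) ≡ x + y * (27 * q) + suc (r + q * 27)
      within = solve-∀
    from-shape (lo , hi , edge , inj₂ (inj₁ (c-lo , c-hi , f-step))) = record
      { i = h ; D = suc (r + (p + h * 2) * 27) ; i<K = ≤-<-trans h≤q q<K ; edge = edge ; D≡±d = inj₁ refl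
      ; difference = begin
          f hi + c hi * (27 * h)                         ≡⟨ cong₂ (λ x y → x + y * (27 * h)) f-step c-hi ⟩
          f lo + (suc r + 27 * p) + 2 * (27 * h)         ≡⟨ across (f lo) r p h ⟩
          f lo + 0 * (27 * h) + suc (r + (p + h * 2) * 27)  ≡˘⟨ cong (λ z → f lo + z * (27 * h) + suc (r + (p + h * 2) * 27)) c-lo ⟩
          L h lo + suc (r + (p + h * 2) * 27)            ∎ }
      where
      open ≡-Reasoning
      h≤q : h ≤ p + h * 2
      h≤q = ≤-trans (m≤m*n h 2) (m≤n+m (h * 2) p)
      across : ∀ x r p h → x + (suc r + 27 * p) + 2 * (27 * h) ≡ x + 0 * (27 * h) + suc (r + (p + h * 2) * 27)
      across = solve-∀
    from-shape (lo , hi , edge , inj₂ (inj₂ (c-lo , c-hi , f-step))) = record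
      { i = i ; D = 55 ∸ t₀ + 54 * i ; i<K = s≤s (m∸n≤m k h) ; edge = edge ; D≡±d = inj₂ wraps-around
      ; difference = begin
          f hi + c hi * (27 * i)                         ≡⟨ cong₂ (λ x y → x + y * (27 * i)) f-step c-hi ⟩
          f lo + (55 ∸ t₀) + 2 * (27 * i)                ≡⟨ wrapped (f lo) (55 ∸ t₀) i ⟩
          f lo + 0 * (27 * i) + (55 ∸ t₀ + 54 * i)       ≡˘⟨ cong (λ z → f lo + z * (27 * i) + (55 ∸ t₀ + 54 * i)) c-lo ⟩
          L i lo + (55 ∸ t₀ + 54 * i)                    ∎ }
      where
      open ≡-Reasoning
      i = k ∸ h
      t₀ = suc r + 27 * p
      t₀≤55 : t₀ ≤ 55
      t₀≤55 = ≤-trans (+-mono-≤ r<27 (*-monoʳ-≤ 27 (s≤s⁻¹ p<2))) (n≤1+n 54)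
      h≤k : h ≤ k
      h≤k = s≤s⁻¹ (≤-<-trans (≤-trans (m≤m*n h 2) (m≤n+m (h * 2) p)) q<K)
      wrapped : ∀ x e i → x + e + 2 * (27 * i) ≡ x + 0 * (27 * i) + (e + 54 * i)
      wrapped = solve-∀
      regroup : ∀ e r p h i → e + 54 * i + suc (r + (p + h * 2) * 27) ≡ e + (suc r + 27 * p) + 54 * (i + h)
      regroup = solve-∀
      wraps-around : 55 ∸ t₀ + 54 * i + suc (r + (p + h * 2) * 27) ≡ n
      wraps-around = begin
        55 ∸ t₀ + 54 * i + suc (r + (p + h * 2) * 27)   ≡⟨ regroup (55 ∸ t₀) r p h i ⟩
        55 ∸ t₀ + t₀ + 54 * (i + h)                      ≡⟨ cong₂ (λ x y → x + 54 * y) (m∸n+n≡m t₀≤55) (m∸n+n≡m h≤k) ⟩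
        55 + 54 * k                                      ≡˘⟨ cong suc (*-suc 54 k) ⟩
        n                                                ∎

  realise-small : ∀ t → 1 ≤ t → t ≤ 27 * K → Realises t
  realise-small (suc t₁) _ t≤27K = subst Realises (cong suc (sym t₁≡digits))
    (realise-digits (t₁ % 27) (q % 2) (q / 2) (m%n<n t₁ 27) (m%n<n q 2) (subst (_< K) (m≡m%n+[m/n]*n q 2) q<K))
    where
    q = t₁ / 27
    t₁≡digits : t₁ ≡ t₁ % 27 + (q % 2 + q / 2 * 2) * 27
    t₁≡digits = trans (m≡m%n+[m/n]*n t₁ 27) (cong (λ z → t₁ % 27 + z * 27) (m≡m%n+[m/n]*n q 2))
    q<K : q < K
    q<K = *-cancelʳ-< 27 q K (begin-strict
      q * 27                   ≤⟨ m≤n+m (q * 27) (t₁ % 27) ⟩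
      t₁ % 27 + q * 27         ≡˘⟨ m≡m%n+[m/n]*n t₁ 27 ⟩
      t₁                       <⟨ t≤27K ⟩
      27 * K                   ≡⟨ *-comm 27 K ⟩
      K * 27                   ∎)
      where open ≤-Reasoning

  realise : ∀ d → 1 ≤ d → d < n → Realises d
  realise d 1≤d d<n = by-size (d ≤? 27 * K)
    where
    by-size : Dec (d ≤ 27 * K) → Realises d
    by-size (yes d≤27K) = realise-small d 1≤d d≤27K
    by-size (no d≰27K)  = subst Realises (m∸[m∸n]≡n (<⇒≤ d<n))
          (realises-complement (m∸n≤m n d) (realise-small (n ∸ d) (m<n⇒0<n∸m d<n) n∸d≤27K))
      where
      n∸d≤27K : n ∸ d ≤ 27 * K
      n∸d≤27K = begin
        n ∸ d                          ≤⟨ ∸-monoʳ-≤ n (≰⇒> d≰27K) ⟩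
        n ∸ suc (27 * K)               ≡⟨ cong (_∸ suc (27 * K)) (halves K) ⟩
        27 * K + suc (27 * K) ∸ suc (27 * K)  ≡⟨ m+n∸n≡m (27 * K) (suc (27 * K)) ⟩
        27 * K                         ∎
        where
        open ≤-Reasoning
        halves : ∀ K → suc (54 * K) ≡ 27 * K + suc (27 * K)
        halves = solve-∀

  design : IsDesign G n blocks
  design = isDesign-by-counting blocks (blocks-injective L-injective) size-identity (covered-by-differences realise)
    where
    open Counting G loopless
    size-identity : length blocks * (length G * 2) ≡ n * (n ∸ 1)
    size-identity = begin
      length blocks * (length G * 2)   ≡⟨ cong₂ (λ a b → a * (b * 2)) length-blocks size ⟩
      K * n * (27 * 2)                 ≡⟨ count k ⟩
      n * (n ∸ 1)                      ∎
      where
      open ≡-Reasoning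
      count : ∀ k → suc k * suc (54 * suc k) * (27 * 2) ≡ suc (54 * suc k) * (54 * suc k)
      count = solve-∀

-- Designs of order 27m + 1 for odd m

halve : ∀ t → ∃ λ h → t ≡ h * 2 ⊎ t ≡ suc (h * 2)
halve zero    = 0 , inj₁ refl
halve (suc t) with halve t
... | h , inj₁ refl = h , inj₂ refl
... | h , inj₂ refl = suc h , inj₁ refl

±-multiple : ∀ k s t → s ≡ 1 ⊎ s ≡ 2 → 1 ≤ t → t < suc (2 * k) →
             ∃ λ D → 1 ≤ D × D ≤ k × (s * D ≡ t ⊎ s * D + t ≡ suc (2 * k))
±-multiple k .1 t (inj₁ refl) 1≤t t<m with t ≤? k
... | yes t≤k = t , 1≤t , t≤k , inj₁ (*-identityˡ t)
... | no t≰k  = suc (2 * k) ∸ t , m<n⇒0<n∸m t<m , m∸t≤k , inj₂ (trans (cong (_+ t) (*-identityˡ _)) (m∸n+n≡m (<⇒≤ t<m)))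
  where
  m∸t≤k : suc (2 * k) ∸ t ≤ k
  m∸t≤k = begin
    suc (2 * k) ∸ t          ≤⟨ ∸-monoʳ-≤ (suc (2 * k)) (≰⇒> t≰k) ⟩
    suc (2 * k) ∸ suc k      ≡⟨ cong (_∸ suc k) (split k) ⟩
    k + suc k ∸ suc k        ≡⟨ m+n∸n≡m k (suc k) ⟩
    k                        ∎
    where
    open ≤-Reasoning
    split : ∀ k → suc (2 * k) ≡ k + suc k
    split = solve-∀
±-multiple k .2 t (inj₂ refl) 1≤t t<m with halve t
... | h , inj₁ refl = h , positive h 1≤t , h≤k , inj₁ (*-comm 2 h)
  where
  positive : ∀ h → 1 ≤ h * 2 → 1 ≤ h
  positive (suc h) _ = s≤s z≤n
  h≤k : h ≤ k
  h≤k = *-cancelʳ-≤ h k 2 (s≤s⁻¹ (≤-trans t<m (≤-reflexive (cong suc (*-comm 2 k)))))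
... | h , inj₂ refl = k ∸ h , m<n⇒0<n∸m h<k , m∸n≤m k h , inj₂ (begin
    2 * (k ∸ h) + suc (h * 2)   ≡⟨ regroup (k ∸ h) h ⟩
    suc (2 * (k ∸ h + h))       ≡⟨ cong (λ z → suc (2 * z)) (m∸n+n≡m (<⇒≤ h<k)) ⟩
    suc (2 * k)                 ∎)
  where
  open ≡-Reasoning
  h<k : h < k
  h<k = *-cancelʳ-< 2 h k (≤-trans (s≤s⁻¹ t<m) (≤-reflexive (*-comm 2 k)))
  regroup : ∀ d h → 2 * d + suc (h * 2) ≡ suc (2 * (d + h))
  regroup = solve-∀

combine-<-cases : ∀ {m n} {g g′ : Fin m} {i i′ : Fin n} →
                  combine g i F.< combine g′ i′ → g F.< g′ ⊎ (g ≡ g′ × i F.< i′)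
combine-<-cases {n = n} {g} {g′} {i} {i′} lt with FP.<-cmp g g′
... | tri< g<g′ _ _ = inj₁ g<g′
... | tri≈ _ refl _ = inj₂ (refl , +-cancelˡ-< (n * toℕ g) (toℕ i) (toℕ i′)
                                    (subst₂ _<_ (FP.toℕ-combine g i) (FP.toℕ-combine g i′) lt))
... | tri> _ _ g′<g = contradiction lt (<⇒≯ (FP.combine-monoˡ-< i′ i g′<g))

_⊖_ : Fin 27 → Fin 27 → Fin 27
j ⊖ i = (toℕ j + (27 ∸ toℕ i)) mod 27

+-⊖ : ∀ i j → (toℕ i + toℕ (j ⊖ i)) % 27 ≡ toℕ j
+-⊖ i j = begin
  (toℕ i + toℕ (j ⊖ i)) % 27                          ≡⟨ cong (_% 27) (+-comm (toℕ i) _) ⟩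
  (toℕ (j ⊖ i) + toℕ i) % 27                          ≡⟨ cong (λ z → (z + toℕ i) % 27) (toℕ-mod {27} (toℕ j + (27 ∸ toℕ i))) ⟩
  ((toℕ j + (27 ∸ toℕ i)) % 27 + toℕ i) % 27          ≡⟨ [m+[n∸k]]%n+k (toℕ j) 27 (<⇒≤ (FP.toℕ<n i)) (FP.toℕ<n j) ⟩
  toℕ j                                               ∎
  where open ≡-Reasoning

-- In the block w ↦ (s + d (c w), t + τ w) the edge lo ε — hi ε joins two points whose ℤ_27-coordinates
-- differ by ε and whose ℤ_m-coordinates differ by d (slope ε).
record ProductLabelling {v} (G : Graph v) : Set where
  field
    c τ             : Fin v → ℕ
    c≤2             : ∀ w → c w ≤ 2
    τ<27            : ∀ w → τ w < 27
    c-τ-injective   : ∀ a b → c a ≡ c b → τ a ≡ τ b → a ≡ b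
    lo hi           : Fin 27 → Fin v
    edge            : ∀ ε → EdgeIn G (lo ε) (hi ε)
    rising          : ∀ ε → c (lo ε) < c (hi ε)
    τ-step          : ∀ ε → (τ (lo ε) + toℕ ε) % 27 ≡ τ (hi ε)
    slope-symmetric : ∀ i j → c (hi (j ⊖ i)) ∸ c (lo (j ⊖ i)) ≡ c (hi (i ⊖ j)) ∸ c (lo (i ⊖ j))

  slope : Fin 27 → ℕ
  slope ε = c (hi ε) ∸ c (lo ε)

  slope-1-or-2 : ∀ ε → slope ε ≡ 1 ⊎ slope ε ≡ 2
  slope-1-or-2 ε with c (hi ε) ∸ c (lo ε) | m<n⇒0<n∸m (rising ε) | ≤-trans (m∸n≤m (c (hi ε)) (c (lo ε))) (c≤2 (hi ε))
  ... | 1 | _ | _ = inj₁ refl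
  ... | 2 | _ | _ = inj₂ refl
  ... | suc (suc (suc _)) | _ | s≤s (s≤s ())

module ProductConstruction {v} (G : Graph v) (loopless : Loopless G) (size : length G ≡ 27)
                           (base : List (Fin v → Fin 28)) (base-design : IsDesign G 28 base)
                           (labelling : ProductLabelling G) (k : ℕ) where
  open ProductLabelling labelling

  m n : ℕ
  m = suc (2 * k)
  n = suc (m * 27)

  -- ∞ is zero and (g, i) ∈ ℤ_m × ℤ_27 is point g i.
  point : Fin m → Fin 27 → Fin n
  point g i = suc (combine g i)

  inGroup : Fin m → Fin 28 → Fin n
  inGroup g zero    = zero
  inGroup g (suc i) = point g i

  inGroup-injective : ∀ g u w → inGroup g u ≡ inGroup g w → u ≡ w
  inGroup-injective g zero    zero    _  = refl
  inGroup-injective g (suc i) (suc j) eq = cong suc (FP.combine-injectiveʳ g i g j (FP.suc-injective eq))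

  shift : ℕ → ℕ → ℕ → Fin v → Fin n
  shift d t s w = point ((s + c w * d) mod m) ((τ w + t) mod 27)

  groupBlocks shiftBlocks blocks : List (Fin v → Fin n)
  groupBlocks = concatMap (λ g → map (inGroup g ∘_) base) (allFin m)
  shiftBlocks = concatMap (λ d → concatMap (λ t → applyUpTo (shift d t) m) (upTo 27)) (applyUpTo suc k)
  blocks      = groupBlocks ++ shiftBlocks

  cd<m : ∀ {d} → d ≤ k → ∀ w → c w * d < m
  cd<m d≤k w = s≤s (*-mono-≤ (c≤2 w) d≤k)

  shift-injective : ∀ {d} → 1 ≤ d → d ≤ k → ∀ t s a b → shift d t s a ≡ shift d t s b → a ≡ b
  shift-injective {d@(suc _)} _ d≤k t s a b eq = c-τ-injective a b c≡ τ≡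
    where
    combine≡ : combine ((s + c a * d) mod m) ((τ a + t) mod 27) ≡ combine ((s + c b * d) mod m) ((τ b + t) mod 27)
    combine≡ = FP.suc-injective eq
    c≡ : c a ≡ c b
    c≡ = *-cancelʳ-≡ (c a) (c b) d (+-%-injective s m (cd<m d≤k a) (cd<m d≤k b) (begin
      (s + c a * d) % m              ≡˘⟨ toℕ-mod (s + c a * d) ⟩
      toℕ ((s + c a * d) mod m)      ≡⟨ cong toℕ (FP.combine-injectiveˡ ((s + c a * d) mod m) ((τ a + t) mod 27) _ _ combine≡) ⟩
      toℕ ((s + c b * d) mod m)      ≡⟨ toℕ-mod (s + c b * d) ⟩
      (s + c b * d) % m              ∎))
      where open ≡-Reasoning
    τ≡ : τ a ≡ τ b
    τ≡ = +-%-injective t 27 (τ<27 a) (τ<27 b) (begin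
      (t + τ a) % 27                 ≡⟨ cong (_% 27) (+-comm t (τ a)) ⟩
      (τ a + t) % 27                 ≡˘⟨ toℕ-mod (τ a + t) ⟩
      toℕ ((τ a + t) mod 27)         ≡⟨ cong toℕ (FP.combine-injectiveʳ ((s + c a * d) mod m) ((τ a + t) mod 27) ((s + c b * d) mod m) _ combine≡) ⟩
      toℕ ((τ b + t) mod 27)         ≡⟨ toℕ-mod (τ b + t) ⟩
      (τ b + t) % 27                 ≡⟨ cong (_% 27) (+-comm (τ b) t) ⟩
      (t + τ b) % 27                 ∎)
      where open ≡-Reasoning

  groupBlocks-injective : AllInjective groupBlocks
  groupBlocks-injective φ∈ with ∈-concatMap⁻′ (λ g → map (inGroup g ∘_) base) (allFin m) φ∈
  ... | g , _ , φ∈copies with ∈-map⁻ (inGroup g ∘_) φ∈copies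
  ...   | β , β∈base , refl = λ a b eq → IsDesign.injective base-design β∈base a b (inGroup-injective g _ _ eq)

  shiftBlocks-injective : AllInjective shiftBlocks
  shiftBlocks-injective φ∈
    with ∈-concatMap⁻′ (λ d → concatMap (λ t → applyUpTo (shift d t) m) (upTo 27)) (applyUpTo suc k) φ∈
  ... | d , d∈ , φ∈d with ∈-applyUpTo⁻ suc d∈ | ∈-concatMap⁻′ (λ t → applyUpTo (shift d t) m) (upTo 27) φ∈d
  ...   | d′ , d′<k , refl | t , _ , φ∈t with ∈-applyUpTo⁻ (shift d t) φ∈t
  ...     | s , _ , refl = shift-injective (s≤s z≤n) d′<k t s

  blocks-injective : AllInjective blocks
  blocks-injective φ∈ with ∈-++⁻ groupBlocks φ∈
  ... | inj₁ φ∈groups = groupBlocks-injective φ∈groups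
  ... | inj₂ φ∈shifts = shiftBlocks-injective φ∈shifts

  length-base : length base ≡ 14
  length-base = *-cancelʳ-≡ (length base) 14 54 (begin
    length base * 54                  ≡˘⟨ cong (λ e → length base * (e * 2)) size ⟩
    length base * (length G * 2)      ≡⟨ Counting.design-size G loopless base-design ⟩
    28 * 27                           ∎)
    where open ≡-Reasoning

  size-identity : length blocks * (length G * 2) ≡ n * (n ∸ 1)
  size-identity = begin
    length blocks * (length G * 2)
      ≡⟨ cong₂ (λ b e → b * (e * 2)) (length-++ groupBlocks) size ⟩
    (length groupBlocks + length shiftBlocks) * 54
      ≡⟨ cong (λ b → b * 54) (cong₂ _+_ groups shifts) ⟩
    (m * 14 + k * (27 * m)) * 54
      ≡⟨ count k ⟩
    n * (n ∸ 1) ∎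
    where
    open ≡-Reasoning
    groups : length groupBlocks ≡ m * 14
    groups = trans (length-concatMap (λ g → map (inGroup g ∘_) base) (allFin m) (λ g → trans (length-map (inGroup g ∘_) base) length-base))
                   (cong (_* 14) (length-tabulate {n = m} id))
    shifts : length shiftBlocks ≡ k * (27 * m)
    shifts = trans (length-concatMap (λ d → concatMap (λ t → applyUpTo (shift d t) m) (upTo 27)) (applyUpTo suc k) (λ d →
                     trans (length-concatMap (λ t → applyUpTo (shift d t) m) (upTo 27) {m} (λ t → length-applyUpTo (shift d t) m))
                           (cong (_* m) (length-upTo 27))))
                   (cong (_* (27 * m)) (length-applyUpTo suc k))
    count : ∀ k → (suc (2 * k) * 14 + k * (27 * suc (2 * k))) * 54 ≡ suc (suc (2 * k) * 27) * (suc (2 * k) * 27)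
    count = solve-∀

  group-covered : ∀ g {u w} → u F.< w → 1 ≤ coverCount G blocks (inGroup g u) (inGroup g w)
  group-covered g {u} {w} u<w
    with covered-hits G base (≤-reflexive (sym (IsDesign.partition base-design u w u<w)))
  ... | β , β∈base , e , e∈G , hit = hits-covered φ∈blocks e∈G
          (subst T (sym (hits-image (inGroup g) (inGroup-injective g) β u w e)) hit)
    where
    φ∈blocks : inGroup g ∘ β ∈ blocks
    φ∈blocks = ∈-++⁺ˡ (∈-concatMap⁺′ (λ g → map (inGroup g ∘_) base) (∈-allFin g) (∈-map⁺ (inGroup g ∘_) β∈base))

  shift-≡-point : ∀ {d t s w g i} → (s + c w * d) % m ≡ toℕ g → (τ w + t) % 27 ≡ toℕ i → shift d t s w ≡ point g i
  shift-≡-point {d} {t} {s} {w} eg ei =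
    cong₂ point (FP.toℕ-injective (trans (toℕ-mod (s + c w * d)) eg)) (FP.toℕ-injective (trans (toℕ-mod (τ w + t)) ei))

  shift-covers : ∀ {d} → 1 ≤ d → d ≤ k → ∀ ε gP iP gQ jQ →
                 (toℕ gP + slope ε * d) % m ≡ toℕ gQ → (toℕ iP + toℕ ε) % 27 ≡ toℕ jQ →
                 1 ≤ coverCount G blocks (point gP iP) (point gQ jQ)
  shift-covers {d@(suc d′)} _ d≤k ε gP iP gQ jQ group-step position-step =
    subst₂ (λ x y → 1 ≤ coverCount G blocks x y) lo↦P hi↦Q (edge-covered φ∈blocks (edge ε))
    where
    t = (toℕ iP + (27 ∸ τ (lo ε))) % 27
    s = (toℕ gP + (m ∸ c (lo ε) * d)) % m
    φ∈blocks : shift d t s ∈ blocks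
    φ∈blocks = ∈-++⁺ʳ groupBlocks (∈-concatMap⁺′ (λ d → concatMap (λ t → applyUpTo (shift d t) m) (upTo 27))
                 (∈-applyUpTo⁺ suc d≤k)
                 (∈-concatMap⁺′ (λ t → applyUpTo (shift d t) m) (∈-upTo⁺ (m%n<n (toℕ iP + (27 ∸ τ (lo ε))) 27))
                   (∈-applyUpTo⁺ (shift d t) (m%n<n (toℕ gP + (m ∸ c (lo ε) * d)) m))))
    group-lo : (s + c (lo ε) * d) % m ≡ toℕ gP
    group-lo = [m+[n∸k]]%n+k (toℕ gP) m (<⇒≤ (cd<m d≤k (lo ε))) (FP.toℕ<n gP)
    position-lo : (τ (lo ε) + t) % 27 ≡ toℕ iP
    position-lo = trans (cong (_% 27) (+-comm (τ (lo ε)) t)) ([m+[n∸k]]%n+k (toℕ iP) 27 (<⇒≤ (τ<27 (lo ε))) (FP.toℕ<n iP))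
    lo↦P : shift d t s (lo ε) ≡ point gP iP
    lo↦P = shift-≡-point {d} {t} {s} {lo ε} group-lo position-lo
    hi↦Q : shift d t s (hi ε) ≡ point gQ jQ
    hi↦Q = shift-≡-point {d} {t} {s} {hi ε} (begin
      (s + c (hi ε) * d) % m                 ≡˘⟨ cong (λ x → (s + x * d) % m) (m+[n∸m]≡n (<⇒≤ (rising ε))) ⟩
      (s + (c (lo ε) + slope ε) * d) % m     ≡⟨ cong (_% m) (distribute s (c (lo ε)) (slope ε) d) ⟩
      (s + c (lo ε) * d + slope ε * d) % m   ≡⟨ %-congˡ-+ (s + c (lo ε) * d) (toℕ gP) (slope ε * d) m (trans group-lo (sym (m<n⇒m%n≡m (FP.toℕ<n gP)))) ⟩
      (toℕ gP + slope ε * d) % m             ≡⟨ group-step ⟩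
      toℕ gQ                                 ∎) (begin
      (τ (hi ε) + t) % 27                    ≡˘⟨ cong (λ x → (x + t) % 27) (τ-step ε) ⟩
      ((τ (lo ε) + toℕ ε) % 27 + t) % 27     ≡⟨ %-congˡ-+ ((τ (lo ε) + toℕ ε) % 27) (τ (lo ε) + toℕ ε) t 27 (m%n%n≡m%n (τ (lo ε) + toℕ ε) 27) ⟩
      (τ (lo ε) + toℕ ε + t) % 27            ≡⟨ cong (_% 27) (swap (τ (lo ε)) (toℕ ε) t) ⟩
      (τ (lo ε) + t + toℕ ε) % 27            ≡⟨ %-congˡ-+ (τ (lo ε) + t) (toℕ iP) (toℕ ε) 27 (trans position-lo (sym (m<n⇒m%n≡m (FP.toℕ<n iP)))) ⟩
      (toℕ iP + toℕ ε) % 27                  ≡⟨ position-step ⟩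
      toℕ jQ                                 ∎)
      where
      open ≡-Reasoning
      distribute : ∀ s x y d → s + (x + y) * d ≡ s + x * d + y * d
      distribute = solve-∀
      swap : ∀ x y z → x + y + z ≡ x + z + y
      swap = solve-∀

  cross-covered : ∀ {gx gy} → gx F.< gy → ∀ i j → 1 ≤ coverCount G blocks (point gx i) (point gy j)
  cross-covered {gx} {gy} gx<gy i j = by-multiple (±-multiple k (slope (j ⊖ i)) gap (slope-1-or-2 (j ⊖ i)) 1≤gap gap<m)
    where
    gap = toℕ gy ∸ toℕ gx
    1≤gap : 1 ≤ gap
    1≤gap = m<n⇒0<n∸m gx<gy
    gap<m : gap < m
    gap<m = ≤-<-trans (m∸n≤m (toℕ gy) (toℕ gx)) (FP.toℕ<n gy)
    gx+gap≡gy : toℕ gx + gap ≡ toℕ gy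
    gx+gap≡gy = m+[n∸m]≡n (<⇒≤ gx<gy)
    by-multiple : ∃ (λ d → 1 ≤ d × d ≤ k × (slope (j ⊖ i) * d ≡ gap ⊎ slope (j ⊖ i) * d + gap ≡ m)) →
                  1 ≤ coverCount G blocks (point gx i) (point gy j)
    by-multiple (d , 1≤d , d≤k , inj₁ forward) = shift-covers 1≤d d≤k (j ⊖ i) gx i gy j
      (trans (cong (λ z → (toℕ gx + z) % m) forward) (trans (cong (_% m) gx+gap≡gy) (m<n⇒m%n≡m (FP.toℕ<n gy))))
      (+-⊖ i j)
    by-multiple (d , 1≤d , d≤k , inj₂ backward) = subst (1 ≤_) (coverCount-sym G blocks (point gy j) (point gx i))
      (shift-covers 1≤d d≤k (i ⊖ j) gy j gx i
        (trans (cong (_% m) wraps) (trans ([m+n]%n≡m%n (toℕ gx) m) (m<n⇒m%n≡m (FP.toℕ<n gx))))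
        (+-⊖ j i))
      where
      wraps : toℕ gy + slope (i ⊖ j) * d ≡ toℕ gx + m
      wraps = begin
        toℕ gy + slope (i ⊖ j) * d            ≡˘⟨ cong (λ z → toℕ gy + z * d) (slope-symmetric i j) ⟩
        toℕ gy + slope (j ⊖ i) * d            ≡˘⟨ cong (_+ slope (j ⊖ i) * d) gx+gap≡gy ⟩
        toℕ gx + gap + slope (j ⊖ i) * d      ≡⟨ +-assoc (toℕ gx) gap _ ⟩
        toℕ gx + (gap + slope (j ⊖ i) * d)    ≡⟨ cong (toℕ gx +_) (trans (+-comm gap _) backward) ⟩
        toℕ gx + m                            ∎
        where open ≡-Reasoning

  decode : ∀ (z : Fin (m * 27)) → ∃₂ λ (g : Fin m) (i : Fin 27) → combine g i ≡ z
  decode z = proj₁ (remQuot {m} 27 z) , proj₂ (remQuot {m} 27 z) , FP.combine-remQuot {m} 27 z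

  covered : ∀ x y → x F.< y → 1 ≤ coverCount G blocks x y
  covered zero (suc y) _ with decode y
  ... | g , j , refl = group-covered g {zero} {suc j} (s≤s z≤n)
  covered (suc x) (suc y) x<y with decode x | decode y
  ... | gx , i , refl | gy , j , refl with combine-<-cases {g = gx} {gy} {i} {j} (s≤s⁻¹ x<y)
  ...   | inj₁ gx<gy          = cross-covered gx<gy i j
  ...   | inj₂ (refl , i<j)   = group-covered gx {suc i} {suc j} (s≤s i<j)

  design : IsDesign G n blocks
  design = Counting.isDesign-by-counting G loopless blocks blocks-injective size-identity covered

design-of-order-1 : ∀ {v} (G : Graph v) → Design G 1
design-of-order-1 G = [] , record { injective = λ () ; partition = λ { zero zero () } }

order-classification : ∀ {v} (G : Graph v) → Loopless G → length G ≡ 27 → (∀ w → 3 ∣ degree G w) →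
                       CyclicLabelling G → (∃ λ base → IsDesign G 28 base) → ProductLabelling G →
                       ∀ n → 1 ≤ n → (Design G n ⇔ n % 27 ≡ 1)
order-classification G loopless size 3∣degree cyclic (base , base-design) product (suc m) _ = mk⇔ necessary sufficient
  where
  open Counting G loopless

  necessary : Design G (suc m) → suc m % 27 ≡ 1
  necessary (D , design) = order≡1-mod-27 (degree-∣-order design 3∣degree zero)
    (divides (length D * 2) (begin
      suc m * m                      ≡˘⟨ design-size design ⟩
      length D * (length G * 2)      ≡⟨ cong (λ e → length D * (e * 2)) size ⟩
      length D * 54                  ≡˘⟨ *-assoc (length D) 2 27 ⟩
      length D * 2 * 27              ∎))
    where open ≡-Reasoning

  sufficient : suc m % 27 ≡ 1 → Design G (suc m)
  sufficient n%27≡1 = by-parity (halve (suc m / 27))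
    where
    order≡ : ∀ {q} → suc m / 27 ≡ q → ∀ n → 1 + q * 27 ≡ n → suc m ≡ n
    order≡ refl n eq = trans (trans (m≡m%n+[m/n]*n (suc m) 27) (cong (_+ suc m / 27 * 27) n%27≡1)) eq
    cyclic-order : ∀ k → 1 + suc k * 2 * 27 ≡ suc (54 * suc k)
    cyclic-order = solve-∀
    product-order : ∀ k → 1 + suc (k * 2) * 27 ≡ suc (suc (2 * k) * 27)
    product-order = solve-∀
    by-parity : (∃ λ h → suc m / 27 ≡ h * 2 ⊎ suc m / 27 ≡ suc (h * 2)) → Design G (suc m)
    by-parity (zero  , inj₁ q≡0)    = subst (Design G) (sym (order≡ q≡0 1 refl)) (design-of-order-1 G)
    by-parity (suc k , inj₁ q≡2h)   = subst (Design G) (sym (order≡ q≡2h _ (cyclic-order k)))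
                                        (_ , CyclicConstruction.design G loopless size cyclic k)
    by-parity (k     , inj₂ q≡2h+1) = subst (Design G) (sym (order≡ q≡2h+1 _ (product-order k)))
                                        (_ , ProductConstruction.design G loopless size base base-design product k)

edgeIn? : ∀ {v} (G : Graph v) lo hi → Dec (EdgeIn G lo hi)
edgeIn? G lo hi = ((lo , hi) ∈? G) ⊎-dec ((hi , lo) ∈? G)
  where open DecMembership (≡-dec FP._≟_ FP._≟_) using (_∈?_)

oriented-edge : ∀ {v} {G : Graph v} {P : Fin v → Fin v → Set} →
                Any (λ (a , b) → P a b ⊎ P b a) G → ∃₂ λ lo hi → EdgeIn G lo hi × P lo hi
oriented-edge any-edge with find any-edge
... | (a , b) , ab∈G , inj₁ Pab = a , b , inj₁ ab∈G , Pab
... | (a , b) , ab∈G , inj₂ Pba = b , a , inj₂ ab∈G , Pba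

loopless-by-decision : ∀ {v} (G : Graph v) → {_ : True (All.all? (λ (a , b) → ¬? (a FP.≟ b)) G)} → Loopless G
loopless-by-decision G {no-loops} = All.lookup (toWitness no-loops)

design-by-decision : ∀ {v n} (G : Graph v) (D : List (Fin v → Fin n)) →
  {_ : True (All.all? (λ φ → FP.all? λ a → FP.all? λ b → (φ a FP.≟ φ b) →-dec (a FP.≟ b)) D)} →
  {_ : True (FP.all? λ x → FP.all? λ y → (x FP.<? y) →-dec (coverCount G D x y ≟ 1))} →
  IsDesign G n D
design-by-decision G D {injective} {partition} = record
  { injective = All.lookup (toWitness injective) ; partition = toWitness partition }

shape? : ∀ {v} (f c : Fin v → ℕ) r p lo hi → Dec (Shape f c r p lo hi)
shape? f c r p lo hi =
      ((c hi ≟ suc (c lo)) ×-dec (f hi ≟ f lo + suc r))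
  ⊎-dec ((c lo ≟ 0) ×-dec (c hi ≟ 2) ×-dec (f hi ≟ f lo + (suc r + 27 * p)))
  ⊎-dec ((c lo ≟ 0) ×-dec (c hi ≟ 2) ×-dec (f hi ≟ f lo + (55 ∸ (suc r + 27 * p))))

cyclic-labelling : ∀ {v} (G : Graph v) (f c : Fin v → ℕ) →
  {_ : True (FP.all? λ w → f w ≤? 54)} → {_ : True (FP.all? λ w → c w ≤? 2)} →
  {_ : True (FP.all? λ a → FP.all? λ b → (f a % 27 ≟ f b % 27) →-dec (a FP.≟ b))} →
  {_ : True (FP.all? λ (r : Fin 27) → FP.all? λ (p : Fin 2) →
              Any.any? (λ (a , b) → shape? f c (toℕ r) (toℕ p) a b ⊎-dec shape? f c (toℕ r) (toℕ p) b a) G)} →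
  CyclicLabelling G
cyclic-labelling G f c {f≤54} {c≤2} {f-inj} {shapes} = record
  { f = f ; c = c ; f≤54 = toWitness f≤54 ; c≤2 = toWitness c≤2 ; f-injective-mod-27 = toWitness f-inj
  ; shapes = λ r p r<27 p<2 → subst₂ (λ r p → ∃₂ λ lo hi → EdgeIn G lo hi × Shape f c r p lo hi)
      (FP.toℕ-fromℕ< r<27) (FP.toℕ-fromℕ< p<2) (oriented-edge (toWitness shapes (F.fromℕ< r<27) (F.fromℕ< p<2))) }

product-labelling : ∀ {v} (G : Graph v) (c τ : Fin v → ℕ) (edges : Fin 27 → Fin v × Fin v) →
  let lo = proj₁ ∘ edges ; hi = proj₂ ∘ edges in
  {_ : True (FP.all? λ w → c w ≤? 2)} → {_ : True (FP.all? λ w → τ w <? 27)} →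
  {_ : True (FP.all? λ a → FP.all? λ b → (c a ≟ c b) →-dec ((τ a ≟ τ b) →-dec (a FP.≟ b)))} →
  {_ : True (FP.all? λ ε → edgeIn? G (lo ε) (hi ε))} →
  {_ : True (FP.all? λ ε → c (lo ε) <? c (hi ε))} →
  {_ : True (FP.all? λ ε → (τ (lo ε) + toℕ ε) % 27 ≟ τ (hi ε))} →
  {_ : True (FP.all? λ i → FP.all? λ j → c (hi (j ⊖ i)) ∸ c (lo (j ⊖ i)) ≟ c (hi (i ⊖ j)) ∸ c (lo (i ⊖ j)))} →
  ProductLabelling G
product-labelling G c τ edges {c≤2} {τ<27} {c-τ-inj} {edge} {rising} {τ-step} {symmetric} = record
  { c = c ; τ = τ ; c≤2 = toWitness c≤2 ; τ<27 = toWitness τ<27 ; c-τ-injective = toWitness c-τ-inj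
  ; lo = proj₁ ∘ edges ; hi = proj₂ ∘ edges ; edge = toWitness edge ; rising = toWitness rising
  ; τ-step = toWitness τ-step ; slope-symmetric = toWitness symmetric }

-- Certificates; vertex-indexed tables list their values at vertices 1, …, 18 of the snark.

block : Vec ℕ 18 → Fin 18 → Fin 28
block images w = lookup images w mod 28

cyclic₁₁ : CyclicLabelling B₁₁
cyclic₁₁ = cyclic-labelling B₁₁
  (lookup (18 ∷ 17 ∷ 48 ∷ 36 ∷ 15 ∷ 12 ∷ 35 ∷ 10 ∷ 50 ∷ 26 ∷ 5 ∷ 33 ∷ 29 ∷ 27 ∷ 47 ∷ 24 ∷ 52 ∷ 31 ∷ []))
  (lookup (2 ∷ 0 ∷ 2 ∷ 1 ∷ 0 ∷ 1 ∷ 2 ∷ 0 ∷ 2 ∷ 1 ∷ 0 ∷ 2 ∷ 1 ∷ 0 ∷ 2 ∷ 0 ∷ 2 ∷ 1 ∷ []))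

base₁₁ : List (Fin 18 → Fin 28)
base₁₁ =
    block (0 ∷ 1 ∷ 18 ∷ 9 ∷ 23 ∷ 22 ∷ 13 ∷ 21 ∷ 7 ∷ 6 ∷ 8 ∷ 10 ∷ 4 ∷ 27 ∷ 16 ∷ 15 ∷ 20 ∷ 3 ∷ [])
  ∷ block (1 ∷ 2 ∷ 19 ∷ 10 ∷ 24 ∷ 23 ∷ 7 ∷ 22 ∷ 8 ∷ 0 ∷ 9 ∷ 11 ∷ 5 ∷ 21 ∷ 17 ∷ 16 ∷ 14 ∷ 4 ∷ [])
  ∷ block (2 ∷ 3 ∷ 20 ∷ 11 ∷ 25 ∷ 24 ∷ 8 ∷ 23 ∷ 9 ∷ 1 ∷ 10 ∷ 12 ∷ 6 ∷ 22 ∷ 18 ∷ 17 ∷ 15 ∷ 5 ∷ [])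
  ∷ block (3 ∷ 4 ∷ 14 ∷ 12 ∷ 26 ∷ 25 ∷ 9 ∷ 24 ∷ 10 ∷ 2 ∷ 11 ∷ 13 ∷ 0 ∷ 23 ∷ 19 ∷ 18 ∷ 16 ∷ 6 ∷ [])
  ∷ block (4 ∷ 5 ∷ 15 ∷ 13 ∷ 27 ∷ 26 ∷ 10 ∷ 25 ∷ 11 ∷ 3 ∷ 12 ∷ 7 ∷ 1 ∷ 24 ∷ 20 ∷ 19 ∷ 17 ∷ 0 ∷ [])
  ∷ block (5 ∷ 6 ∷ 16 ∷ 7 ∷ 21 ∷ 27 ∷ 11 ∷ 26 ∷ 12 ∷ 4 ∷ 13 ∷ 8 ∷ 2 ∷ 25 ∷ 14 ∷ 20 ∷ 18 ∷ 1 ∷ [])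
  ∷ block (6 ∷ 0 ∷ 17 ∷ 8 ∷ 22 ∷ 21 ∷ 12 ∷ 27 ∷ 13 ∷ 5 ∷ 7 ∷ 9 ∷ 3 ∷ 26 ∷ 15 ∷ 14 ∷ 19 ∷ 2 ∷ [])
  ∷ block (21 ∷ 13 ∷ 12 ∷ 19 ∷ 8 ∷ 17 ∷ 16 ∷ 25 ∷ 7 ∷ 6 ∷ 18 ∷ 14 ∷ 24 ∷ 5 ∷ 27 ∷ 22 ∷ 3 ∷ 2 ∷ [])
  ∷ block (22 ∷ 7 ∷ 13 ∷ 20 ∷ 9 ∷ 18 ∷ 17 ∷ 26 ∷ 8 ∷ 0 ∷ 19 ∷ 15 ∷ 25 ∷ 6 ∷ 21 ∷ 23 ∷ 4 ∷ 3 ∷ [])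
  ∷ block (23 ∷ 8 ∷ 7 ∷ 14 ∷ 10 ∷ 19 ∷ 18 ∷ 27 ∷ 9 ∷ 1 ∷ 20 ∷ 16 ∷ 26 ∷ 0 ∷ 22 ∷ 24 ∷ 5 ∷ 4 ∷ [])
  ∷ block (24 ∷ 9 ∷ 8 ∷ 15 ∷ 11 ∷ 20 ∷ 19 ∷ 21 ∷ 10 ∷ 2 ∷ 14 ∷ 17 ∷ 27 ∷ 1 ∷ 23 ∷ 25 ∷ 6 ∷ 5 ∷ [])
  ∷ block (25 ∷ 10 ∷ 9 ∷ 16 ∷ 12 ∷ 14 ∷ 20 ∷ 22 ∷ 11 ∷ 3 ∷ 15 ∷ 18 ∷ 21 ∷ 2 ∷ 24 ∷ 26 ∷ 0 ∷ 6 ∷ [])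
  ∷ block (26 ∷ 11 ∷ 10 ∷ 17 ∷ 13 ∷ 15 ∷ 14 ∷ 23 ∷ 12 ∷ 4 ∷ 16 ∷ 19 ∷ 22 ∷ 3 ∷ 25 ∷ 27 ∷ 1 ∷ 0 ∷ [])
  ∷ block (27 ∷ 12 ∷ 11 ∷ 18 ∷ 7 ∷ 16 ∷ 15 ∷ 24 ∷ 13 ∷ 5 ∷ 17 ∷ 20 ∷ 23 ∷ 4 ∷ 26 ∷ 21 ∷ 2 ∷ 1 ∷ [])
  ∷ []

product₁₁ : ProductLabelling B₁₁
product₁₁ = product-labelling B₁₁
  (lookup (0 ∷ 1 ∷ 0 ∷ 2 ∷ 2 ∷ 1 ∷ 0 ∷ 2 ∷ 1 ∷ 1 ∷ 2 ∷ 2 ∷ 1 ∷ 1 ∷ 0 ∷ 2 ∷ 0 ∷ 1 ∷ []))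
  (lookup (4 ∷ 0 ∷ 13 ∷ 24 ∷ 2 ∷ 11 ∷ 17 ∷ 12 ∷ 6 ∷ 7 ∷ 6 ∷ 23 ∷ 20 ∷ 18 ∷ 14 ∷ 0 ∷ 25 ∷ 1 ∷ []))
  (lookup ((9 — 11) ∷ (6 — 8) ∷ (17 — 16) ∷ (13 — 12) ∷ (15 — 14) ∷ (14 — 12) ∷ (9 — 8) ∷ (13 — 16) ∷ (1 — 8)
        ∷ (17 — 10) ∷ (7 — 2) ∷ (3 — 4) ∷ (6 — 12) ∷ (13 — 11) ∷ (15 — 18) ∷ (3 — 18) ∷ (3 — 5) ∷ (7 — 10)
        ∷ (9 — 4) ∷ (15 — 11) ∷ (17 — 14) ∷ (7 — 6) ∷ (10 — 5) ∷ (1 — 2) ∷ (2 — 4) ∷ (1 — 5) ∷ (18 — 16) ∷ []))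

cyclic₁₂ : CyclicLabelling B₁₂
cyclic₁₂ = cyclic-labelling B₁₂
  (lookup (25 ∷ 50 ∷ 26 ∷ 34 ∷ 27 ∷ 29 ∷ 5 ∷ 46 ∷ 39 ∷ 21 ∷ 43 ∷ 28 ∷ 15 ∷ 40 ∷ 17 ∷ 24 ∷ 20 ∷ 10 ∷ []))
  (lookup (1 ∷ 2 ∷ 0 ∷ 1 ∷ 2 ∷ 1 ∷ 0 ∷ 2 ∷ 2 ∷ 0 ∷ 2 ∷ 1 ∷ 0 ∷ 2 ∷ 1 ∷ 2 ∷ 1 ∷ 0 ∷ []))

base₁₂ : List (Fin 18 → Fin 28)
base₁₂ =
    block (14 ∷ 21 ∷ 1 ∷ 10 ∷ 3 ∷ 26 ∷ 4 ∷ 12 ∷ 15 ∷ 16 ∷ 22 ∷ 17 ∷ 2 ∷ 25 ∷ 13 ∷ 9 ∷ 20 ∷ 19 ∷ [])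
  ∷ block (15 ∷ 22 ∷ 2 ∷ 11 ∷ 4 ∷ 27 ∷ 5 ∷ 13 ∷ 16 ∷ 17 ∷ 23 ∷ 18 ∷ 3 ∷ 26 ∷ 7 ∷ 10 ∷ 14 ∷ 20 ∷ [])
  ∷ block (16 ∷ 23 ∷ 3 ∷ 12 ∷ 5 ∷ 21 ∷ 6 ∷ 7 ∷ 17 ∷ 18 ∷ 24 ∷ 19 ∷ 4 ∷ 27 ∷ 8 ∷ 11 ∷ 15 ∷ 14 ∷ [])
  ∷ block (17 ∷ 24 ∷ 4 ∷ 13 ∷ 6 ∷ 22 ∷ 0 ∷ 8 ∷ 18 ∷ 19 ∷ 25 ∷ 20 ∷ 5 ∷ 21 ∷ 9 ∷ 12 ∷ 16 ∷ 15 ∷ [])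
  ∷ block (18 ∷ 25 ∷ 5 ∷ 7 ∷ 0 ∷ 23 ∷ 1 ∷ 9 ∷ 19 ∷ 20 ∷ 26 ∷ 14 ∷ 6 ∷ 22 ∷ 10 ∷ 13 ∷ 17 ∷ 16 ∷ [])
  ∷ block (19 ∷ 26 ∷ 6 ∷ 8 ∷ 1 ∷ 24 ∷ 2 ∷ 10 ∷ 20 ∷ 14 ∷ 27 ∷ 15 ∷ 0 ∷ 23 ∷ 11 ∷ 7 ∷ 18 ∷ 17 ∷ [])
  ∷ block (20 ∷ 27 ∷ 0 ∷ 9 ∷ 2 ∷ 25 ∷ 3 ∷ 11 ∷ 14 ∷ 15 ∷ 21 ∷ 16 ∷ 1 ∷ 24 ∷ 12 ∷ 8 ∷ 19 ∷ 18 ∷ [])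
  ∷ block (7 ∷ 13 ∷ 25 ∷ 10 ∷ 24 ∷ 22 ∷ 3 ∷ 9 ∷ 6 ∷ 20 ∷ 23 ∷ 5 ∷ 21 ∷ 2 ∷ 14 ∷ 0 ∷ 8 ∷ 17 ∷ [])
  ∷ block (8 ∷ 7 ∷ 26 ∷ 11 ∷ 25 ∷ 23 ∷ 4 ∷ 10 ∷ 0 ∷ 14 ∷ 24 ∷ 6 ∷ 22 ∷ 3 ∷ 15 ∷ 1 ∷ 9 ∷ 18 ∷ [])
  ∷ block (9 ∷ 8 ∷ 27 ∷ 12 ∷ 26 ∷ 24 ∷ 5 ∷ 11 ∷ 1 ∷ 15 ∷ 25 ∷ 0 ∷ 23 ∷ 4 ∷ 16 ∷ 2 ∷ 10 ∷ 19 ∷ [])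
  ∷ block (10 ∷ 9 ∷ 21 ∷ 13 ∷ 27 ∷ 25 ∷ 6 ∷ 12 ∷ 2 ∷ 16 ∷ 26 ∷ 1 ∷ 24 ∷ 5 ∷ 17 ∷ 3 ∷ 11 ∷ 20 ∷ [])
  ∷ block (11 ∷ 10 ∷ 22 ∷ 7 ∷ 21 ∷ 26 ∷ 0 ∷ 13 ∷ 3 ∷ 17 ∷ 27 ∷ 2 ∷ 25 ∷ 6 ∷ 18 ∷ 4 ∷ 12 ∷ 14 ∷ [])
  ∷ block (12 ∷ 11 ∷ 23 ∷ 8 ∷ 22 ∷ 27 ∷ 1 ∷ 7 ∷ 4 ∷ 18 ∷ 21 ∷ 3 ∷ 26 ∷ 0 ∷ 19 ∷ 5 ∷ 13 ∷ 15 ∷ [])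
  ∷ block (13 ∷ 12 ∷ 24 ∷ 9 ∷ 23 ∷ 21 ∷ 2 ∷ 8 ∷ 5 ∷ 19 ∷ 22 ∷ 4 ∷ 27 ∷ 1 ∷ 20 ∷ 6 ∷ 7 ∷ 16 ∷ [])
  ∷ []

product₁₂ : ProductLabelling B₁₂
product₁₂ = product-labelling B₁₂
  (lookup (1 ∷ 2 ∷ 2 ∷ 0 ∷ 0 ∷ 0 ∷ 1 ∷ 2 ∷ 2 ∷ 1 ∷ 0 ∷ 0 ∷ 2 ∷ 1 ∷ 2 ∷ 0 ∷ 2 ∷ 1 ∷ []))
  (lookup (11 ∷ 13 ∷ 18 ∷ 4 ∷ 3 ∷ 24 ∷ 24 ∷ 10 ∷ 11 ∷ 8 ∷ 10 ∷ 20 ∷ 3 ∷ 12 ∷ 16 ∷ 18 ∷ 8 ∷ 15 ∷ []))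
  (lookup ((6 — 7) ∷ (18 — 15) ∷ (1 — 2) ∷ (10 — 9) ∷ (14 — 15) ∷ (5 — 10) ∷ (11 — 15) ∷ (4 — 9) ∷ (5 — 1)
        ∷ (4 — 2) ∷ (12 — 13) ∷ (7 — 17) ∷ (16 — 13) ∷ (6 — 8) ∷ (4 — 3) ∷ (5 — 3) ∷ (7 — 2) ∷ (16 — 17)
        ∷ (12 — 9) ∷ (12 — 14) ∷ (11 — 13) ∷ (6 — 3) ∷ (18 — 8) ∷ (14 — 17) ∷ (16 — 18) ∷ (11 — 10) ∷ (1 — 8) ∷ []))

theorem2 : ∀ (G : Graph 18) → G ≡ B₁₁ ⊎ G ≡ B₁₂ →
           ∀ (n : ℕ) → 1 ≤ n → (Design G n ⇔ n % 27 ≡ 1)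
theorem2 G (inj₁ refl) = order-classification B₁₁ (loopless-by-decision B₁₁) refl
  (toWitness {a? = FP.all? λ w → 3 ∣? degree B₁₁ w} _) cyclic₁₁ (base₁₁ , design-by-decision B₁₁ base₁₁) product₁₁
theorem2 G (inj₂ refl) = order-classification B₁₂ (loopless-by-decision B₁₂) refl
  (toWitness {a? = FP.all? λ w → 3 ∣? degree B₁₂ w} _) cyclic₁₂ (base₁₂ , design-by-decision B₁₂ base₁₂) product₁₂
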